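{- Let $G$ be a disjoint union of paths (isolated vertices counted as trivial paths). Then $G$ is a $\langle 2,2\rangle$ CCE graph if and only if $G$ is not isomorphic to a nontrivial path.
   Context: All graphs and digraphs are simple (no loops, no multiple arcs). The CCE graph $CCE(D)$ of a digraph $D$ is the graph on $V(D)$ in which distinct $u,v$ are adjacent iff there exist vertices $x,y$ with $(y,u),(y,v),(u,x),(v,x)$ all arcs of $D$. A $\langle 2,2\rangle$ digraph is a digraph in which every vertex has indegree at most $2$ and outdegree at most $2$; a $\langle 2,2\rangle$ CCE graph is a graph isomorphic to the CCE graph of some $\langle 2,2\rangle$ digraph. A nontrivial path is a path with at least two vertices. -}

module Defs where

open import Data.Nat using (ℕ; zero; suc; _+_; _≤_; _≡ᵇ_)
open import Data.Bool using (Bool; true; false; _∧_; _∨_; if_then_else_)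
open import Data.Fin using (Fin; toℕ)
open import Data.List using (List; map; allFin)
open import Data.Nat.ListAction using (sum)
open import Data.Product using (Σ; ∃; ∃-syntax; _×_)
open import Function.Bundles using (_↔_; Inverse)
open import Relation.Binary.PropositionalEquality using (_≡_; _≢_)

record Graph : Set where
  field
    size : ℕ
    adj  : Fin size → Fin size → Bool
open Graph public

IsSimpleGraph : Graph → Set
IsSimpleGraph G = (∀ u v → adj G u v ≡ adj G v u) × (∀ v → adj G v v ≡ false)

_≅_ : Graph → Graph → Set
G ≅ H = Σ (Fin (size G) ↔ Fin (size H)) λ f →
          ∀ u v → adj G u v ≡ adj H (Inverse.to f u) (Inverse.to f v)

-- Linear forest on 0..n-1: i ~ i+1 iff c i = true; no other edges.
-- Every disjoint union of paths (isolated vertices = trivial paths) is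
-- isomorphic to one of these and conversely.
linForest : (n : ℕ) → (ℕ → Bool) → Graph
linForest n c = record
  { size = n
  ; adj  = λ i j → ((suc (toℕ i) ≡ᵇ toℕ j) ∧ c (toℕ i))
                 ∨ ((suc (toℕ j) ≡ᵇ toℕ i) ∧ c (toℕ j)) }

pathGraph : ℕ → Graph
pathGraph k = linForest k (λ _ → true)

IsDisjointUnionOfPaths : Graph → Set
IsDisjointUnionOfPaths G = ∃[ c ] (G ≅ linForest (size G) c)

IsNontrivialPath : Graph → Set
IsNontrivialPath G = ∃[ k ] (2 ≤ k × G ≅ pathGraph k)

record Digraph : Set where
  field
    vsize   : ℕ
    arc     : Fin vsize → Fin vsize → Bool
    noLoops : ∀ v → arc v v ≡ false
open Digraph public

indeg : (D : Digraph) → Fin (vsize D) → ℕ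
indeg D v = sum (map (λ w → if arc D w v then 1 else 0) (allFin (vsize D)))

outdeg : (D : Digraph) → Fin (vsize D) → ℕ
outdeg D v = sum (map (λ w → if arc D v w then 1 else 0) (allFin (vsize D)))

Is22 : Digraph → Set
Is22 D = ∀ v → indeg D v ≤ 2 × outdeg D v ≤ 2

CCEAdj : (D : Digraph) → Fin (vsize D) → Fin (vsize D) → Set
CCEAdj D u v = u ≢ v × ∃[ x ] ∃[ y ]
  (arc D y u ≡ true × arc D y v ≡ true × arc D u x ≡ true × arc D v x ≡ true)

IsoToCCE : Graph → Digraph → Set
IsoToCCE G D = Σ (Fin (size G) ↔ Fin (vsize D)) λ f →
  ∀ u v → (adj G u v ≡ true → CCEAdj D (Inverse.to f u) (Inverse.to f v))
        × (CCEAdj D (Inverse.to f u) (Inverse.to f v) → adj G u v ≡ true)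

Is22CCEGraph : Graph → Set
Is22CCEGraph G = ∃[ D ] (Is22 D × IsoToCCE G D)

module Submission where

-- Suppose the path 0 – 1 – ⋯ – K, K ≥ 1, is the CCE graph of a ⟨2,2⟩ digraph, and let sink i and
-- source i be a common out- and in-neighbour of i and i + 1. Degree at most 2 makes both
-- injective, and the in-neighbours of sink i are exactly i and i + 1. If some inner vertex j is no
-- sink, its in-neighbours source (j - 1) ≠ source j can only be the ends 0 and K; otherwise every
-- pair source j, source (j + 1) is {i, i + 1} where sink i = j + 1, so source moves by ±1 in a
-- fixed direction and must hit source j ∈ {j, j + 1}, a loop. So 0 and K share an out-neighbour,
-- and dually an in-neighbour, i.e. they are adjacent, which forces K = 1; but then sink 0 ∉ {0, 1}.
--
-- Conversely, for orderings λ and π of the vertices the digraph with arcs λ j → π j and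
-- λ (j + 1) → π j has as CCE graph exactly the pairs consecutive in both λ and π. A linear forest
-- with at least two components is realised this way, or as a disjoint union of such pieces: two
-- paths by listing the second before the first, three paths by a similar reordering, and a
-- general forest by splitting off its first two paths and recursing, unless the rest is one path.

open import Defs
open import Data.Bool using (Bool; true; false; _∧_; _∨_; not; if_then_else_; T)
open import Data.Bool.Properties using (T-≡; T-∧; T-∨; ∨-zeroʳ)
open import Data.Empty using (⊥; ⊥-elim)
open import Data.Fin using (Fin; toℕ; fromℕ<) renaming (zero to fzero; suc to fsuc)
open import Data.Fin.Properties using (toℕ-fromℕ<; toℕ-injective; toℕ<n)
open import Data.List using (map; allFin; tabulate)
open import Data.List.Properties using (map-tabulate)
open import Data.Nat hiding (Ordering; less; equal; greater; compare)
open import Data.Nat.DivMod using (_mod_; m<n⇒m%n≡m)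
open import Data.Nat.Induction using (<-rec)
open import Data.Nat.ListAction using (sum)
open import Data.Nat.Properties
open import Algebra.Properties.CommutativeMonoid.Sum +-0-commutativeMonoid
  using (∑-distrib-+) renaming (sum to ∑)
open import Data.Product using (∃; ∃₂; _×_; _,_; proj₁; proj₂)
open import Data.Sum using (_⊎_; inj₁; inj₂; [_,_]′)
open import Data.Unit using (tt)
open import Function using (_∘_; flip)
open import Function.Bundles using (_↔_; Inverse; Equivalence)
open import Function.Properties.Inverse using (↔-sym; ↔-trans)
open import Relation.Binary.Definitions using (tri<; tri≈; tri>)
open import Relation.Binary.PropositionalEquality
open import Relation.Nullary using (¬_; yes; no; contradiction; ¬?)
open import Relation.Nullary.Decidable using (_×-dec_; decidable-stable)

open Inverse using (to; from; strictlyInverseˡ; strictlyInverseʳ)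

true≢false : true ≢ false
true≢false ()

≡ᵇ-true⇒≡ : ∀ {m n} → (m ≡ᵇ n) ≡ true → m ≡ n
≡ᵇ-true⇒≡ {m} {n} e = ≡ᵇ⇒≡ m n (subst T (sym e) tt)

≡⇒≡ᵇ-true : ∀ {m n} → m ≡ n → (m ≡ᵇ n) ≡ true
≡⇒≡ᵇ-true {m} {n} e = Equivalence.to T-≡ (≡⇒≡ᵇ m n e)

≢⇒≡ᵇ-false : ∀ {m n} → m ≢ n → (m ≡ᵇ n) ≡ false
≢⇒≡ᵇ-false {m} {n} m≢n with m ≡ᵇ n in e
... | false = refl
... | true = contradiction (≡ᵇ-true⇒≡ e) m≢n

≡ᵇ-shift : ∀ p m n → ((p + m) ≡ᵇ (p + n)) ≡ (m ≡ᵇ n)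
≡ᵇ-shift zero m n = refl
≡ᵇ-shift (suc p) m n = ≡ᵇ-shift p m n

<ᵇ-true : ∀ {m n} → m < n → (m <ᵇ n) ≡ true
<ᵇ-true m<n = Equivalence.to T-≡ (<⇒<ᵇ m<n)

<ᵇ-false : ∀ {m n} → n ≤ m → (m <ᵇ n) ≡ false
<ᵇ-false {m} {n} n≤m with m <ᵇ n in e
... | false = refl
... | true = contradiction (<ᵇ⇒< m n (subst T (sym e) _)) (≤⇒≯ n≤m)

Bool-ext : ∀ {a b} → (a ≡ true → b ≡ true) → (b ≡ true → a ≡ true) → a ≡ b
Bool-ext {false} {false} _ _ = refl
Bool-ext {false} {true} _ b⇒a = b⇒a refl
Bool-ext {true} {false} a⇒b _ = sym (a⇒b refl)
Bool-ext {true} {true} _ _ = refl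

∧-true : ∀ {x y} → x ∧ y ≡ true → x ≡ true × y ≡ true
∧-true {true} {true} _ = refl , refl

≢0∧≢1⇒2≤ : ∀ {x} → x ≢ 0 → x ≢ 1 → 2 ≤ x
≢0∧≢1⇒2≤ {zero} x≢0 _ = contradiction refl x≢0
≢0∧≢1⇒2≤ {suc zero} _ x≢1 = contradiction refl x≢1
≢0∧≢1⇒2≤ {suc (suc x)} _ _ = s≤s (s≤s z≤n)

halve : ∀ n → ∃ λ h → h + h ≡ n ⊎ suc (h + h) ≡ n
halve zero = 0 , inj₁ refl
halve (suc n) with halve n
... | h , inj₁ e = h , inj₂ (cong suc e)
... | h , inj₂ e = suc h , inj₁ (trans (cong suc (+-suc h h)) (cong suc e))

pred< : ∀ {a} → 1 ≤ a → pred a < a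
pred< (s≤s _) = ≤-refl

1+pred : ∀ {a} → 1 ≤ a → suc (pred a) ≡ a
1+pred (s≤s _) = refl

m∸n≡1+m∸1+n : ∀ m n → suc n ≤ m → m ∸ n ≡ suc (m ∸ suc n)
m∸n≡1+m∸1+n (suc m) zero _ = refl
m∸n≡1+m∸1+n (suc m) (suc n) (s≤s 1+n≤m) = m∸n≡1+m∸1+n m n 1+n≤m

m∸1+j<m : ∀ m j → suc j ≤ m → m ∸ suc j < m
m∸1+j<m m j 1+j≤m = ∸-monoʳ-< {m} {suc j} {0} (s≤s z≤n) 1+j≤m

m∸1+[m∸1+j]≡j : ∀ m j → suc j ≤ m → m ∸ suc (m ∸ suc j) ≡ j
m∸1+[m∸1+j]≡j m j 1+j≤m =
  suc-injective (trans (sym (m∸n≡1+m∸1+n m (m ∸ suc j) (m∸1+j<m m j 1+j≤m))) (m∸[m∸n]≡n 1+j≤m))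

bit : Bool → ℕ
bit b = if b then 1 else 0

-- indeg D v and outdeg D v are count (λ w → arc D w v) and count (arc D v) by definition.
count : ∀ {n} → (Fin n → Bool) → ℕ
count {n} f = sum (map (λ w → if f w then 1 else 0) (allFin n))

sum-tabulate : ∀ {n} (g : Fin n → ℕ) → sum (tabulate g) ≡ ∑ g
sum-tabulate {zero} g = refl
sum-tabulate {suc n} g = cong (g fzero +_) (sum-tabulate (g ∘ fsuc))

count≡∑ : ∀ {n} (f : Fin n → Bool) → count f ≡ ∑ (bit ∘ f)
count≡∑ {n} f = trans (cong sum (map-tabulate (λ w → w) (bit ∘ f))) (sum-tabulate (bit ∘ f))

∑-mono-≤ : ∀ {n} {g h : Fin n → ℕ} → (∀ i → g i ≤ h i) → ∑ g ≤ ∑ h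
∑-mono-≤ {zero} g≤h = z≤n
∑-mono-≤ {suc n} g≤h = +-mono-≤ (g≤h fzero) (∑-mono-≤ (g≤h ∘ fsuc))

term≤∑ : ∀ {n} (g : Fin n → ℕ) i → g i ≤ ∑ g
term≤∑ g fzero = m≤m+n (g fzero) _
term≤∑ g (fsuc i) = ≤-trans (term≤∑ (g ∘ fsuc) i) (m≤n+m _ (g fzero))

∑-zero : ∀ n → ∑ {n} (λ _ → 0) ≡ 0
∑-zero zero = refl
∑-zero (suc n) = ∑-zero n

∑δ≤1 : ∀ {n} a → ∑ {n} (λ w → bit (toℕ w ≡ᵇ a)) ≤ 1
∑δ≤1 {zero} a = z≤n
∑δ≤1 {suc n} zero = ≤-reflexive (cong suc (∑-zero n))
∑δ≤1 {suc n} (suc a) = ∑δ≤1 {n} a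

module _ {n : ℕ} where

  δ : ℕ → Fin n → ℕ
  δ a w = bit (toℕ w ≡ᵇ a)

  δ-self : (a : Fin n) → δ (toℕ a) a ≡ 1
  δ-self a rewrite ≡⇒≡ᵇ-true {toℕ a} refl = refl

  count≤2 : (f : Fin n → Bool) (a b : ℕ) → (∀ w → f w ≡ true → toℕ w ≡ a ⊎ toℕ w ≡ b) → count f ≤ 2
  count≤2 f a b only-a-b = begin
    count f                        ≡⟨ count≡∑ f ⟩
    ∑ (bit ∘ f)                    ≤⟨ ∑-mono-≤ pointwise ⟩
    ∑ (λ w → δ a w + δ b w)        ≡⟨ ∑-distrib-+ (δ a) (δ b) ⟩
    ∑ (δ a) + ∑ (δ b)              ≤⟨ +-mono-≤ (∑δ≤1 {n} a) (∑δ≤1 {n} b) ⟩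
    2                              ∎
    where
    open ≤-Reasoning
    pointwise : ∀ w → bit (f w) ≤ δ a w + δ b w
    pointwise w with f w in fw
    ... | false = z≤n
    ... | true with only-a-b w fw
    ...   | inj₁ refl rewrite ≡⇒≡ᵇ-true {toℕ w} refl = s≤s z≤n
    ...   | inj₂ refl rewrite ≡⇒≡ᵇ-true {toℕ w} refl = m≤n+m 1 _

  3≤count : (f : Fin n → Bool) {a b c : Fin n} → a ≢ b → a ≢ c → b ≢ c →
            f a ≡ true → f b ≡ true → f c ≡ true → 3 ≤ count f
  3≤count f {a} {b} {c} a≢b a≢c b≢c fa fb fc = begin
    3                                        ≡⟨ cong₂ _+_ (sym (δ-self a)) (cong₂ _+_ (sym (δ-self b)) (sym (δ-self c))) ⟩
    δ (toℕ a) a + (δ (toℕ b) b + δ (toℕ c) c) ≤⟨ +-mono-≤ (term≤∑ (δ (toℕ a)) a) (+-mono-≤ (term≤∑ (δ (toℕ b)) b) (term≤∑ (δ (toℕ c)) c)) ⟩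
    ∑ (δ (toℕ a)) + (∑ (δ (toℕ b)) + ∑ (δ (toℕ c)))
        ≡⟨ cong (∑ (δ (toℕ a)) +_) (∑-distrib-+ {n} (δ (toℕ b)) (δ (toℕ c))) ⟨
    ∑ (δ (toℕ a)) + ∑ (λ w → δ (toℕ b) w + δ (toℕ c) w)
        ≡⟨ ∑-distrib-+ {n} (δ (toℕ a)) (λ w → δ (toℕ b) w + δ (toℕ c) w) ⟨
    ∑ (λ w → δ (toℕ a) w + (δ (toℕ b) w + δ (toℕ c) w)) ≤⟨ ∑-mono-≤ pointwise ⟩
    ∑ (bit ∘ f)                              ≡⟨ count≡∑ f ⟨
    count f                                  ∎
    where
    open ≤-Reasoning
    hit : ∀ {w} → f w ≡ true → 1 ≤ bit (f w)
    hit fw rewrite fw = s≤s z≤n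
    same : ∀ {x} w → (toℕ w ≡ᵇ toℕ x) ≡ true → w ≡ x
    same w = toℕ-injective ∘ ≡ᵇ-true⇒≡
    pointwise : ∀ w → δ (toℕ a) w + (δ (toℕ b) w + δ (toℕ c) w) ≤ bit (f w)
    pointwise w with toℕ w ≡ᵇ toℕ a in p | toℕ w ≡ᵇ toℕ b in q | toℕ w ≡ᵇ toℕ c in r
    ... | true  | true  | _     = contradiction (trans (sym (same w p)) (same w q)) a≢b
    ... | true  | _     | true  = contradiction (trans (sym (same w p)) (same w r)) a≢c
    ... | _     | true  | true  = contradiction (trans (sym (same w q)) (same w r)) b≢c
    ... | true  | false | false = hit (subst (λ z → f z ≡ true) (sym (same w p)) fa)
    ... | false | true  | false = hit (subst (λ z → f z ≡ true) (sym (same w q)) fb)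
    ... | false | false | true  = hit (subst (λ z → f z ≡ true) (sym (same w r)) fc)
    ... | false | false | false = z≤n

forestAdj : (ℕ → Bool) → ℕ → ℕ → Bool
forestAdj c u v = ((suc u ≡ᵇ v) ∧ c u) ∨ ((suc v ≡ᵇ u) ∧ c v)

ForestEdge : (ℕ → Bool) → ℕ → ℕ → Set
ForestEdge c u v = (suc u ≡ v × c u ≡ true) ⊎ (suc v ≡ u × c v ≡ true)

forestAdj⇒edge : ∀ c u v → forestAdj c u v ≡ true → ForestEdge c u v
forestAdj⇒edge c u v adj with Equivalence.to T-∨ (Equivalence.from T-≡ adj)
... | inj₁ t = inj₁ (≡ᵇ⇒≡ _ _ (proj₁ (Equivalence.to T-∧ t)) , Equivalence.to T-≡ (proj₂ (Equivalence.to T-∧ t)))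
... | inj₂ t = inj₂ (≡ᵇ⇒≡ _ _ (proj₁ (Equivalence.to T-∧ t)) , Equivalence.to T-≡ (proj₂ (Equivalence.to T-∧ t)))

edge⇒forestAdj : ∀ c u v → ForestEdge c u v → forestAdj c u v ≡ true
edge⇒forestAdj c u .(suc u) (inj₁ (refl , cu)) rewrite ≡⇒≡ᵇ-true {u} refl | cu = refl
edge⇒forestAdj c .(suc v) v (inj₂ (refl , cv)) rewrite ≡⇒≡ᵇ-true {v} refl | cv = ∨-zeroʳ _

forestAdj-false : ∀ c u v → ¬ ForestEdge c u v → forestAdj c u v ≡ false
forestAdj-false c u v ¬edge with forestAdj c u v in adj
... | false = refl
... | true = contradiction (forestAdj⇒edge c u v adj) ¬edge

forestAdj-trivial : ∀ {n} c → n ≤ 1 → ∀ u v → u < n → v < n → false ≡ forestAdj c u v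
forestAdj-trivial c n≤1 zero zero _ _ = refl
forestAdj-trivial c n≤1 (suc u) _ u<n _ = contradiction (≤-trans u<n n≤1) λ { (s≤s ()) }
forestAdj-trivial c n≤1 zero (suc v) _ v<n = contradiction (≤-trans v<n n≤1) λ { (s≤s ()) }

forestEdge-cong : ∀ {N c c′ u v} → (∀ i → suc i < N → c i ≡ c′ i) → u < N → v < N →
                  ForestEdge c u v → ForestEdge c′ u v
forestEdge-cong c≡c′ _ v<N (inj₁ (refl , cu)) = inj₁ (refl , trans (sym (c≡c′ _ v<N)) cu)
forestEdge-cong c≡c′ u<N _ (inj₂ (refl , cv)) = inj₂ (refl , trans (sym (c≡c′ _ u<N)) cv)

forestAdj-cong : ∀ {N c c′} → (∀ i → suc i < N → c i ≡ c′ i) →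
                 ∀ u v → u < N → v < N → forestAdj c u v ≡ forestAdj c′ u v
forestAdj-cong {c = c} {c′} c≡c′ u v u<N v<N = Bool-ext
  (edge⇒forestAdj c′ u v ∘ forestEdge-cong c≡c′ u<N v<N ∘ forestAdj⇒edge c u v)
  (edge⇒forestAdj c u v ∘ forestEdge-cong (λ i → sym ∘ c≡c′ i) u<N v<N ∘ forestAdj⇒edge c′ u v)

forestAdj-shift : ∀ p c t s → forestAdj c (p + t) (p + s) ≡ forestAdj (λ i → c (p + i)) t s
forestAdj-shift p c t s = cong₂ _∨_
  (cong (_∧ c (p + t)) (trans (cong (_≡ᵇ p + s) (sym (+-suc p t))) (≡ᵇ-shift p (suc t) s)))
  (cong (_∧ c (p + s)) (trans (cong (_≡ᵇ p + t) (sym (+-suc p s))) (≡ᵇ-shift p (suc s) t)))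

-- Hamiltonian paths in CCE graphs

CommonOut : (ℕ → ℕ → Bool) → ℕ → ℕ → ℕ → Set
CommonOut A K u v = ∃ λ x → x ≤ K × A u x ≡ true × A v x ≡ true

AtMostTwo : ℕ → (ℕ → Set) → Set
AtMostTwo K P = ∀ {a b c} → a ≤ K → b ≤ K → c ≤ K → a ≢ b → a ≢ c → b ≢ c → P a → P b → P c → ⊥

module ConsecutiveWitness (K : ℕ) (A : ℕ → ℕ → Bool)
  (irrefl : ∀ i → A i i ≡ false)
  (in≤2 : ∀ t → t ≤ K → AtMostTwo K (λ s → A s t ≡ true))
  (step : ∀ i → i < K → CommonOut A K i (suc i)) where

  X : ℕ → ℕ
  X i with i <? K
  ... | yes i<K = proj₁ (step i i<K)
  ... | no _ = 0

  X-spec : ∀ {i} → i < K → X i ≤ K × A i (X i) ≡ true × A (suc i) (X i) ≡ true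
  X-spec {i} i<K with i <? K
  ... | yes p = proj₂ (step i p)
  ... | no ¬p = contradiction i<K ¬p

  X≤K : ∀ {i} → i < K → X i ≤ K
  X≤K = proj₁ ∘ X-spec

  arc-to-X : ∀ {i} → i < K → A i (X i) ≡ true
  arc-to-X = proj₁ ∘ proj₂ ∘ X-spec

  arc-suc-to-X : ∀ {i} → i < K → A (suc i) (X i) ≡ true
  arc-suc-to-X = proj₂ ∘ proj₂ ∘ X-spec

  no-loop : ∀ {s t} → A s t ≡ true → s ≢ t
  no-loop {s} st refl = true≢false (trans (sym st) (irrefl s))

  X≢i : ∀ {i} → i < K → X i ≢ i
  X≢i i<K = no-loop (arc-to-X i<K) ∘ sym

  X≢suc-i : ∀ {i} → i < K → X i ≢ suc i
  X≢suc-i i<K = no-loop (arc-suc-to-X i<K) ∘ sym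

  X-injective : ∀ {i j} → i < j → j < K → X i ≢ X j
  X-injective {i} {j} i<j j<K Xi≡Xj =
    in≤2 (X j) (X≤K j<K) (<⇒≤ i<K) i<K j<K (<⇒≢ (n<1+n i)) (<⇒≢ (<-≤-trans i<j (n≤1+n j)))
         (<⇒≢ (s≤s i<j))
         (subst (λ z → A i z ≡ true) Xi≡Xj (arc-to-X i<K))
         (subst (λ z → A (suc i) z ≡ true) Xi≡Xj (arc-suc-to-X i<K))
         (arc-suc-to-X j<K)
    where
    i<K : i < K
    i<K = <-trans i<j j<K

  in-neighbour-of-X : ∀ {i s} → i < K → s ≤ K → A s (X i) ≡ true → s ≡ i ⊎ s ≡ suc i
  in-neighbour-of-X {i} {s} i<K s≤K sXi with s ≟ i | s ≟ suc i
  ... | yes s≡i | _ = inj₁ s≡i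
  ... | no _ | yes s≡1+i = inj₂ s≡1+i
  ... | no s≢i | no s≢1+i =
    ⊥-elim (in≤2 (X i) (X≤K i<K) s≤K (<⇒≤ i<K) i<K s≢i s≢1+i (<⇒≢ (n<1+n i))
                 sXi (arc-to-X i<K) (arc-suc-to-X i<K))

-- All vertices of the digraph are among 0, …, K, so 0 – 1 – ⋯ – K is a Hamiltonian path of its CCE graph.
module HamiltonianPath (K : ℕ) (1≤K : 1 ≤ K) (A : ℕ → ℕ → Bool)
  (irrefl : ∀ i → A i i ≡ false)
  (out≤2 : ∀ s → s ≤ K → AtMostTwo K (λ t → A s t ≡ true))
  (in≤2 : ∀ t → t ≤ K → AtMostTwo K (λ s → A s t ≡ true))
  (out-step : ∀ i → i < K → CommonOut A K i (suc i))
  (in-step : ∀ i → i < K → CommonOut (flip A) K i (suc i)) where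

  open ConsecutiveWitness K A irrefl in≤2 out-step public
    renaming (X to sink; X≤K to sink≤K; arc-to-X to arc-to-sink; arc-suc-to-X to arc-suc-to-sink;
              X≢i to sink≢i; X≢suc-i to sink≢suc-i; X-injective to sink-injective;
              in-neighbour-of-X to in-neighbour-of-sink)
  open ConsecutiveWitness K (flip A) irrefl out≤2 in-step public
    renaming (X to source; X≤K to source≤K; arc-to-X to arc-from-source; arc-suc-to-X to arc-from-source-to-suc;
              X≢i to source≢i; X≢suc-i to source≢suc-i; X-injective to source-injective)
    using ()

  2≤K : 2 ≤ K
  2≤K = ≤-trans (≢0∧≢1⇒2≤ (sink≢i 1≤K) (sink≢suc-i 1≤K)) (sink≤K 1≤K)

  out-neighbour-of-interior : ∀ {s t} → suc s < K → t ≤ K → A (suc s) t ≡ true → t ≡ sink s ⊎ t ≡ sink (suc s)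
  out-neighbour-of-interior {s} {t} 1+s<K t≤K st with t ≟ sink s | t ≟ sink (suc s)
  ... | yes e | _ = inj₁ e
  ... | no _ | yes e = inj₂ e
  ... | no t≢Xs | no t≢X1+s =
    ⊥-elim (out≤2 (suc s) (<⇒≤ 1+s<K) t≤K (sink≤K s<K) (sink≤K 1+s<K) t≢Xs t≢X1+s
                  (sink-injective (n<1+n s) 1+s<K) st (arc-suc-to-sink s<K) (arc-to-sink 1+s<K))
    where
    s<K : s < K
    s<K = <-trans (n<1+n s) 1+s<K

  NotSink : ℕ → Set
  NotSink j = ∀ i → i < K → sink i ≢ j

  in-neighbour-of-non-sink : ∀ {j s} → j ≤ K → NotSink j → s ≤ K → A s j ≡ true → s ≡ 0 ⊎ s ≡ K
  in-neighbour-of-non-sink {s = zero} _ _ _ _ = inj₁ refl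
  in-neighbour-of-non-sink {j} {suc s} j≤K ¬sink s≤K sj with suc s ≟ K
  ... | yes e = inj₂ e
  ... | no 1+s≢K =
    ⊥-elim ([ ¬sink s s<K ∘ sym , ¬sink (suc s) 1+s<K ∘ sym ]′ (out-neighbour-of-interior 1+s<K j≤K sj))
    where
    1+s<K : suc s < K
    1+s<K = ≤∧≢⇒< s≤K 1+s≢K
    s<K : s < K
    s<K = <-trans (n<1+n s) 1+s<K

  -- If some interior vertex j is no sink, its in-neighbours source (j - 1) and source j are 0 and K.
  non-sink⇒ends-share : ∀ {j} → 0 < j → j < K → NotSink j → CommonOut A K 0 K
  non-sink⇒ends-share {suc j} _ 1+j<K ¬sink =
    ends (in-neighbour-of-non-sink (<⇒≤ 1+j<K) ¬sink (source≤K j<K) (arc-from-source-to-suc j<K))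
         (in-neighbour-of-non-sink (<⇒≤ 1+j<K) ¬sink (source≤K 1+j<K) (arc-from-source 1+j<K))
    where
    j<K : j < K
    j<K = <-trans (n<1+n j) 1+j<K
    distinct : source j ≢ source (suc j)
    distinct = source-injective (n<1+n j) 1+j<K
    ends : source j ≡ 0 ⊎ source j ≡ K → source (suc j) ≡ 0 ⊎ source (suc j) ≡ K → CommonOut A K 0 K
    ends (inj₁ e) (inj₁ e′) = contradiction (trans e (sym e′)) distinct
    ends (inj₂ e) (inj₂ e′) = contradiction (trans e (sym e′)) distinct
    ends (inj₁ e) (inj₂ e′) = suc j , <⇒≤ 1+j<K ,
      subst (λ z → A z (suc j) ≡ true) e (arc-from-source-to-suc j<K) ,
      subst (λ z → A z (suc j) ≡ true) e′ (arc-from-source 1+j<K)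
    ends (inj₂ e) (inj₁ e′) = suc j , <⇒≤ 1+j<K ,
      subst (λ z → A z (suc j) ≡ true) e′ (arc-from-source 1+j<K) ,
      subst (λ z → A z (suc j) ≡ true) e (arc-from-source-to-suc j<K)

  AllSinks : Set
  AllSinks = ∀ j → 0 < j → j < K → ∃ λ i → i < K × sink i ≡ j

  Up Down : ℕ → Set
  Up j = source (suc j) ≡ suc (source j)
  Down j = source j ≡ suc (source (suc j))

  -- Both sources of consecutive vertices j, j + 1 are in-neighbours of the sink i with sink i = j + 1.
  source-step : AllSinks → ∀ j → suc j < K → Up j ⊎ Down j
  source-step all j 1+j<K with all (suc j) (s≤s z≤n) 1+j<K
  ... | i , i<K , sink-i≡1+j =
    step (in-neighbour-of-sink i<K (source≤K j<K) (subst (λ z → A (source j) z ≡ true) (sym sink-i≡1+j) (arc-from-source-to-suc j<K)))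
         (in-neighbour-of-sink i<K (source≤K 1+j<K) (subst (λ z → A (source (suc j)) z ≡ true) (sym sink-i≡1+j) (arc-from-source 1+j<K)))
    where
    j<K : j < K
    j<K = <-trans (n<1+n j) 1+j<K
    distinct : source j ≢ source (suc j)
    distinct = source-injective (n<1+n j) 1+j<K
    step : source j ≡ i ⊎ source j ≡ suc i → source (suc j) ≡ i ⊎ source (suc j) ≡ suc i → Up j ⊎ Down j
    step (inj₁ e) (inj₁ e′) = contradiction (trans e (sym e′)) distinct
    step (inj₂ e) (inj₂ e′) = contradiction (trans e (sym e′)) distinct
    step (inj₁ e) (inj₂ e′) = inj₁ (trans e′ (cong suc (sym e)))
    step (inj₂ e) (inj₁ e′) = inj₂ (trans e (cong suc (sym e′)))

  no-turn-up : ∀ {j} → suc (suc j) < K → Up j → ¬ Down (suc j)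
  no-turn-up {j} 2+j<K up down =
    source-injective (≤-trans (n<1+n j) (n≤1+n (suc j))) 2+j<K (suc-injective (trans (sym up) down))

  no-turn-down : ∀ {j} → suc (suc j) < K → Down j → ¬ Up (suc j)
  no-turn-down {j} 2+j<K down up =
    source-injective (≤-trans (n<1+n j) (n≤1+n (suc j))) 2+j<K (trans down (sym up))

  always-up : AllSinks → Up 0 → ∀ j → suc j < K → Up j
  always-up all up₀ zero _ = up₀
  always-up all up₀ (suc j) 2+j<K with source-step all (suc j) 2+j<K
  ... | inj₁ up = up
  ... | inj₂ down = contradiction down (no-turn-up 2+j<K (always-up all up₀ j (<-trans (n<1+n _) 2+j<K)))

  always-down : AllSinks → Down 0 → ∀ j → suc j < K → Down j
  always-down all down₀ zero _ = down₀
  always-down all down₀ (suc j) 2+j<K with source-step all (suc j) 2+j<K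
  ... | inj₂ down = down
  ... | inj₁ up = contradiction up (no-turn-down 2+j<K (always-down all down₀ j (<-trans (n<1+n _) 2+j<K)))

  ascending : (∀ j → suc j < K → Up j) → ∀ j → j < K → source j ≡ source 0 + j
  ascending up zero _ = sym (+-identityʳ _)
  ascending up (suc j) 1+j<K =
    trans (up j 1+j<K) (trans (cong suc (ascending up j (<-trans (n<1+n j) 1+j<K))) (sym (+-suc _ j)))

  descending : (∀ j → suc j < K → Down j) → ∀ j → j < K → source j + j ≡ source 0
  descending down zero _ = +-identityʳ _
  descending down (suc j) 1+j<K =
    trans (+-suc _ j) (trans (cong (_+ j) (sym (down j 1+j<K))) (descending down j (<-trans (n<1+n j) 1+j<K)))

  -- source 0 ≥ 2, so climbing by one per step overshoots K.
  ¬ascending : ¬ (∀ j → suc j < K → Up j)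
  ¬ascending up = <⇒≱ (s≤s (≤-reflexive (sym (suc-pred K)))) (begin
    2 + pred K              ≤⟨ +-monoˡ-≤ (pred K) (≢0∧≢1⇒2≤ (source≢i 1≤K) (source≢suc-i 1≤K)) ⟩
    source 0 + pred K       ≡⟨ ascending up (pred K) (pred<K) ⟨
    source (pred K)         ≤⟨ source≤K pred<K ⟩
    K                       ∎)
    where
    open ≤-Reasoning
    instance
      K≢0 : NonZero K
      K≢0 = >-nonZero 1≤K
    pred<K : pred K < K
    pred<K = subst (pred K <_) (suc-pred K) ≤-refl

  -- Descending by one per step, source j meets the diagonal {j, j + 1} at j = ⌊source 0 / 2⌋.
  ¬descending : ¬ (∀ j → suc j < K → Down j)
  ¬descending down with halve (source 0)
  ... | h , h+h≡s₀⊎1+h+h≡s₀ = meets-diagonal h+h≡s₀⊎1+h+h≡s₀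
    where
    h+h≤s₀ : h + h ≤ source 0
    h+h≤s₀ = [ ≤-reflexive , (λ e → ≤-trans (n≤1+n _) (≤-reflexive e)) ]′ h+h≡s₀⊎1+h+h≡s₀
    h<K : h < K
    h<K = ≰⇒> λ K≤h → <⇒≱ 1≤K (+-cancelˡ-≤ K K 0
            (≤-trans (+-mono-≤ K≤h K≤h) (≤-trans h+h≤s₀ (≤-trans (source≤K 1≤K) (≤-reflexive (sym (+-identityʳ K)))))))
    meets-diagonal : h + h ≡ source 0 ⊎ suc (h + h) ≡ source 0 → ⊥
    meets-diagonal (inj₁ e) = source≢i h<K (+-cancelʳ-≡ h _ _ (trans (descending down h h<K) (sym e)))
    meets-diagonal (inj₂ e) = source≢suc-i h<K (+-cancelʳ-≡ h _ _ (trans (descending down h h<K) (sym e)))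

  all-sinks⇒⊥ : ¬ AllSinks
  all-sinks⇒⊥ all with source-step all 0 2≤K
  ... | inj₁ up₀ = ¬ascending (always-up all up₀)
  ... | inj₂ down₀ = ¬descending (always-down all down₀)

  ends-share-out-neighbour : CommonOut A K 0 K
  ends-share-out-neighbour with anyUpTo? (λ j → (0 <? j) ×-dec ¬? (anyUpTo? (λ i → sink i ≟ j) K)) K
  ... | yes (j , j<K , 0<j , ¬pre) = non-sink⇒ends-share 0<j j<K (λ i i<K e → ¬pre (i , i<K , e))
  ... | no none = ⊥-elim (all-sinks⇒⊥ λ j 0<j j<K →
          decidable-stable (anyUpTo? (λ i → sink i ≟ j) K) (λ ¬pre → none (j , j<K , 0<j , ¬pre)))

IsoToCCE-transport : ∀ {G H D} → G ≅ H → IsoToCCE G D → IsoToCCE H D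
IsoToCCE-transport {G} {H} {D} (f , f-adj) (g , g-cce) = ↔-trans (↔-sym f) g , λ u v →
  (λ adj-uv → proj₁ (g-cce (from f u) (from f v)) (trans (adj-from u v) adj-uv)) ,
  (λ cce → trans (sym (adj-from u v)) (proj₂ (g-cce (from f u) (from f v)) cce))
  where
  adj-from : ∀ u v → adj G (from f u) (from f v) ≡ adj H u v
  adj-from u v = trans (f-adj (from f u) (from f v))
                       (cong₂ (adj H) (strictlyInverseˡ f u) (strictlyInverseˡ f v))

-- The vertices of D are numbered by their position on the path: v i is the i-th one.
module PathAsCCE (D : Digraph) (is22 : Is22 D) (K : ℕ) (cce : IsoToCCE (pathGraph (suc K)) D) where

  φ : Fin (suc K) ↔ Fin (vsize D)
  φ = proj₁ cce

  vertex : ℕ → Fin (suc K)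
  vertex i = i mod suc K

  toℕ-vertex : ∀ {i} → i ≤ K → toℕ (vertex i) ≡ i
  toℕ-vertex i≤K = trans (toℕ-fromℕ< _) (m<n⇒m%n≡m (s≤s i≤K))

  v : ℕ → Fin (vsize D)
  v i = to φ (vertex i)

  index : Fin (vsize D) → ℕ
  index z = toℕ (from φ z)

  index≤K : ∀ z → index z ≤ K
  index≤K z = ≤-pred (toℕ<n (from φ z))

  v-index : ∀ z → v (index z) ≡ z
  v-index z = trans (cong (to φ) (toℕ-injective (toℕ-vertex (index≤K z)))) (strictlyInverseˡ φ z)

  φ-injective : ∀ {x y} → to φ x ≡ to φ y → x ≡ y
  φ-injective {x} {y} e = trans (sym (strictlyInverseʳ φ x)) (trans (cong (from φ) e) (strictlyInverseʳ φ y))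

  v-injective : ∀ {a b} → a ≤ K → b ≤ K → a ≢ b → v a ≢ v b
  v-injective {a} {b} a≤K b≤K a≢b va≡vb = a≢b (begin
    a                         ≡⟨ toℕ-vertex a≤K ⟨
    toℕ (vertex a)            ≡⟨ cong toℕ (φ-injective va≡vb) ⟩
    toℕ (vertex b)            ≡⟨ toℕ-vertex b≤K ⟩
    b                         ∎)
    where open ≡-Reasoning

  A : ℕ → ℕ → Bool
  A i j = arc D (v i) (v j)

  out≤2 : ∀ s → s ≤ K → AtMostTwo K (λ t → A s t ≡ true)
  out≤2 s _ a≤K b≤K c≤K a≢b a≢c b≢c sa sb sc =
    <⇒≱ (3≤count (arc D (v s)) (v-injective a≤K b≤K a≢b) (v-injective a≤K c≤K a≢c) (v-injective b≤K c≤K b≢c)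
                 sa sb sc)
        (proj₂ (is22 (v s)))

  in≤2 : ∀ t → t ≤ K → AtMostTwo K (λ s → A s t ≡ true)
  in≤2 t _ a≤K b≤K c≤K a≢b a≢c b≢c at bt ct =
    <⇒≱ (3≤count (λ w → arc D w (v t)) (v-injective a≤K b≤K a≢b) (v-injective a≤K c≤K a≢c)
                 (v-injective b≤K c≤K b≢c) at bt ct)
        (proj₁ (is22 (v t)))

  step-cce : ∀ i → i < K → CCEAdj D (v i) (v (suc i))
  step-cce i i<K = proj₁ (proj₂ cce (vertex i) (vertex (suc i)))
    (edge⇒forestAdj _ _ _ (inj₁ (trans (cong suc (toℕ-vertex (<⇒≤ i<K))) (sym (toℕ-vertex i<K)) , refl)))

  out-step : ∀ i → i < K → CommonOut A K i (suc i)
  out-step i i<K with step-cce i i<K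
  ... | _ , x , _ , _ , _ , ix , jx = index x , index≤K x ,
    subst (λ z → arc D (v i) z ≡ true) (sym (v-index x)) ix ,
    subst (λ z → arc D (v (suc i)) z ≡ true) (sym (v-index x)) jx

  in-step : ∀ i → i < K → CommonOut (flip A) K i (suc i)
  in-step i i<K with step-cce i i<K
  ... | _ , _ , y , yi , yj , _ = index y , index≤K y ,
    subst (λ z → arc D z (v i) ≡ true) (sym (v-index y)) yi ,
    subst (λ z → arc D z (v (suc i)) ≡ true) (sym (v-index y)) yj

  -- By the Hamiltonian path lemma the ends 0 and K are CCE-adjacent, which a path with K ≥ 2 forbids.
  impossible : 1 ≤ K → ⊥
  impossible 1≤K = <⇒≢ (OutPath.2≤K) (sym (ends-adjacent (forestAdj⇒edge _ _ _ path-adj)))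
    where
    module OutPath = HamiltonianPath K 1≤K A (λ i → noLoops D (v i)) out≤2 in≤2 out-step in-step
    module InPath = HamiltonianPath K 1≤K (flip A) (λ i → noLoops D (v i)) in≤2 out≤2 in-step out-step
    ends-cce : CCEAdj D (v 0) (v K)
    ends-cce = v-injective z≤n ≤-refl (<⇒≢ 1≤K) , v (proj₁ out) , v (proj₁ inn) ,
               proj₁ (proj₂ (proj₂ inn)) , proj₂ (proj₂ (proj₂ inn)) ,
               proj₁ (proj₂ (proj₂ out)) , proj₂ (proj₂ (proj₂ out))
      where
      out : CommonOut A K 0 K
      out = OutPath.ends-share-out-neighbour
      inn : CommonOut (flip A) K 0 K
      inn = InPath.ends-share-out-neighbour
    path-adj : adj (pathGraph (suc K)) (vertex 0) (vertex K) ≡ true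
    path-adj = proj₂ (proj₂ cce (vertex 0) (vertex K)) ends-cce
    ends-adjacent : ForestEdge (λ _ → true) (toℕ (vertex 0)) (toℕ (vertex K)) → K ≡ 1
    ends-adjacent (inj₁ (e , _)) = trans (sym (toℕ-vertex ≤-refl)) (sym (trans (cong suc (sym (toℕ-vertex z≤n))) e))
    ends-adjacent (inj₂ (e , _)) = contradiction (trans e (toℕ-vertex z≤n)) λ ()

22CCE⇒¬nontrivial-path : (G : Graph) → Is22CCEGraph G → ¬ IsNontrivialPath G
22CCE⇒¬nontrivial-path G (D , is22 , cce) (suc K , s≤s 1≤K , G≅P) =
  PathAsCCE.impossible D is22 K (IsoToCCE-transport {D = D} G≅P cce) 1≤K

-- Realisations

WithinTwo : ℕ → (ℕ → Set) → Set
WithinTwo n P = ∃₂ λ a b → ∀ w → w < n → P w → w ≡ a ⊎ w ≡ b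

CCEℕ : ℕ → (ℕ → ℕ → Bool) → ℕ → ℕ → Set
CCEℕ n arrow u v = u ≢ v × ∃₂ λ x y → x < n × y < n ×
  (arrow y u ≡ true × arrow y v ≡ true × arrow u x ≡ true × arrow v x ≡ true)

-- adj, restricted to 0, …, n - 1, is the CCE graph of a ⟨2,2⟩ digraph on 0, …, n - 1.
record Realization (n : ℕ) (adj : ℕ → ℕ → Bool) : Set where
  field
    arrow : ℕ → ℕ → Bool
    arrow-irrefl : ∀ i → arrow i i ≡ false
    out≤2 : ∀ u → u < n → WithinTwo n (λ v → arrow u v ≡ true)
    in≤2 : ∀ v → v < n → WithinTwo n (λ u → arrow u v ≡ true)
    sound : ∀ u v → u < n → v < n → adj u v ≡ true → CCEℕ n arrow u v
    complete : ∀ u v → u < n → v < n → CCEℕ n arrow u v → adj u v ≡ true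

Realization-cong : ∀ {n adj adj′} → (∀ u v → u < n → v < n → adj u v ≡ adj′ u v) →
                   Realization n adj → Realization n adj′
Realization-cong adj≡adj′ R = record
  { arrow = arrow ; arrow-irrefl = arrow-irrefl ; out≤2 = out≤2 ; in≤2 = in≤2
  ; sound = λ u v u<n v<n a → sound u v u<n v<n (trans (adj≡adj′ u v u<n v<n) a)
  ; complete = λ u v u<n v<n cce → trans (sym (adj≡adj′ u v u<n v<n)) (complete u v u<n v<n cce) }
  where open Realization R

edgeless : ∀ n → Realization n (λ _ _ → false)
edgeless n = record
  { arrow = λ _ _ → false ; arrow-irrefl = λ _ → refl
  ; out≤2 = λ _ _ → 0 , 0 , λ _ _ ()
  ; in≤2 = λ _ _ → 0 , 0 , λ _ _ ()
  ; sound = λ _ _ _ _ ()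
  ; complete = λ { _ _ _ _ (_ , _ , _ , _ , _ , () , _) } }

realization⇒22CCE : (G : Graph) (c : ℕ → Bool) → G ≅ linForest (size G) c →
                    Realization (size G) (forestAdj c) → Is22CCEGraph G
realization⇒22CCE G c (f , f-adj) R = D , is22 , f , λ u v →
  (λ a → to-CCE (sound _ _ (toℕ<n _) (toℕ<n _) (trans (sym (f-adj u v)) a))) ,
  (λ cce → trans (f-adj u v) (complete _ _ (toℕ<n _) (toℕ<n _) (from-CCE cce)))
  where
  open Realization R
  n : ℕ
  n = size G
  D : Digraph
  D = record { vsize = n ; arc = λ u v → arrow (toℕ u) (toℕ v) ; noLoops = λ v → arrow-irrefl (toℕ v) }
  is22 : Is22 D
  is22 v with in≤2 (toℕ v) (toℕ<n v) | out≤2 (toℕ v) (toℕ<n v)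
  ... | a , b , only-in | a′ , b′ , only-out =
    count≤2 (λ w → arc D w v) a b (λ w → only-in (toℕ w) (toℕ<n w)) ,
    count≤2 (arc D v) a′ b′ (λ w → only-out (toℕ w) (toℕ<n w))
  to-CCE : ∀ {U V} → CCEℕ n arrow (toℕ U) (toℕ V) → CCEAdj D U V
  to-CCE {U} {V} (U≢V , x , y , x<n , y<n , yU , yV , Ux , Vx) =
    U≢V ∘ cong toℕ , fromℕ< x<n , fromℕ< y<n ,
    subst (λ z → arrow z (toℕ U) ≡ true) (sym (toℕ-fromℕ< y<n)) yU ,
    subst (λ z → arrow z (toℕ V) ≡ true) (sym (toℕ-fromℕ< y<n)) yV ,
    subst (λ z → arrow (toℕ U) z ≡ true) (sym (toℕ-fromℕ< x<n)) Ux ,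
    subst (λ z → arrow (toℕ V) z ≡ true) (sym (toℕ-fromℕ< x<n)) Vx
  from-CCE : ∀ {U V} → CCEAdj D U V → CCEℕ n arrow (toℕ U) (toℕ V)
  from-CCE (U≢V , x , y , arcs) = U≢V ∘ toℕ-injective , toℕ x , toℕ y , toℕ<n x , toℕ<n y , arcs

data Side (p : ℕ) : ℕ → Set where
  low : ∀ {u} → u < p → Side p u
  high : ∀ t → Side p (p + t)

side : ∀ p u → Side p u
side p u with u <? p
... | yes u<p = low u<p
... | no u≮p = subst (Side p) (m+[n∸m]≡n (≮⇒≥ u≮p)) (high (u ∸ p))

blockSum : ℕ → (ℕ → ℕ → Bool) → (ℕ → ℕ → Bool) → ℕ → ℕ → Bool
blockSum p F G u v = if u <ᵇ p then (if v <ᵇ p then F u v else false)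
                     else (if v <ᵇ p then false else G (u ∸ p) (v ∸ p))

module BlockSum (p : ℕ) (F G : ℕ → ℕ → Bool) where

  blockSum-low : ∀ {u v} → u < p → v < p → blockSum p F G u v ≡ F u v
  blockSum-low u<p v<p rewrite <ᵇ-true u<p | <ᵇ-true v<p = refl

  blockSum-high : ∀ {t s} → blockSum p F G (p + t) (p + s) ≡ G t s
  blockSum-high {t} {s} rewrite <ᵇ-false (m≤m+n p t) | <ᵇ-false (m≤m+n p s) | m+n∸m≡n p t | m+n∸m≡n p s = refl

  blockSum-low-high : ∀ {u s} → u < p → blockSum p F G u (p + s) ≡ false
  blockSum-low-high {s = s} u<p rewrite <ᵇ-true u<p | <ᵇ-false (m≤m+n p s) = refl

  blockSum-high-low : ∀ {t v} → v < p → blockSum p F G (p + t) v ≡ false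
  blockSum-high-low {t} v<p rewrite <ᵇ-false (m≤m+n p t) | <ᵇ-true v<p = refl

  low-target : ∀ {u x} → u < p → blockSum p F G u x ≡ true → x < p × F u x ≡ true
  low-target {x = x} u<p ux with side p x
  ... | low x<p = x<p , trans (sym (blockSum-low u<p x<p)) ux
  ... | high _ = contradiction (trans (sym ux) (blockSum-low-high u<p)) true≢false

  low-source : ∀ {y u} → u < p → blockSum p F G y u ≡ true → y < p × F y u ≡ true
  low-source {y} u<p yu with side p y
  ... | low y<p = y<p , trans (sym (blockSum-low y<p u<p)) yu
  ... | high _ = contradiction (trans (sym yu) (blockSum-high-low u<p)) true≢false

  high-target : ∀ {t x} → blockSum p F G (p + t) x ≡ true → ∃ λ s → x ≡ p + s × G t s ≡ true
  high-target {x = x} ux with side p x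
  ... | low x<p = contradiction (trans (sym ux) (blockSum-high-low x<p)) true≢false
  ... | high s = s , refl , trans (sym blockSum-high) ux

  high-source : ∀ {y t} → blockSum p F G y (p + t) ≡ true → ∃ λ s → y ≡ p + s × G s t ≡ true
  high-source {y} yu with side p y
  ... | low y<p = contradiction (trans (sym yu) (blockSum-low-high y<p)) true≢false
  ... | high s = s , refl , trans (sym blockSum-high) yu

module DisjointUnion {p q : ℕ} {A B : ℕ → ℕ → Bool} (R : Realization p A) (S : Realization q B) where

  private
    module R = Realization R
    module S = Realization S
    module Adj = BlockSum p A B
  open BlockSum p R.arrow S.arrow

  arrow : ℕ → ℕ → Bool
  arrow = blockSum p R.arrow S.arrow

  <p+q : ∀ {u} → u < p → u < p + q
  <p+q u<p = <-≤-trans u<p (m≤m+n p q)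

  <q : ∀ {t} → p + t < p + q → t < q
  <q = +-cancelˡ-< p _ _

  arrow-irrefl : ∀ i → arrow i i ≡ false
  arrow-irrefl i with side p i
  ... | low i<p = trans (blockSum-low i<p i<p) (R.arrow-irrefl i)
  ... | high t = trans blockSum-high (S.arrow-irrefl t)

  shift-two : ∀ {a b s} → s ≡ a ⊎ s ≡ b → p + s ≡ p + a ⊎ p + s ≡ p + b
  shift-two = Data.Sum.map (cong (p +_)) (cong (p +_))

  out≤2 : ∀ u → u < p + q → WithinTwo (p + q) (λ v → arrow u v ≡ true)
  out≤2 u _ with side p u
  ... | low u<p with R.out≤2 u u<p
  ...   | a , b , only = a , b , λ w _ uw → only w (proj₁ (low-target u<p uw)) (proj₂ (low-target u<p uw))
  out≤2 u u<n | high t with S.out≤2 t (<q u<n)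
  ...   | a , b , only = p + a , p + b , λ w w<n uw → shift uw w<n
    where
    shift : ∀ {w} → arrow (p + t) w ≡ true → w < p + q → w ≡ p + a ⊎ w ≡ p + b
    shift uw w<n with high-target uw
    ... | s , refl , ts = shift-two (only s (<q w<n) ts)

  in≤2 : ∀ v → v < p + q → WithinTwo (p + q) (λ u → arrow u v ≡ true)
  in≤2 v _ with side p v
  ... | low v<p with R.in≤2 v v<p
  ...   | a , b , only = a , b , λ w _ wv → only w (proj₁ (low-source v<p wv)) (proj₂ (low-source v<p wv))
  in≤2 v v<n | high t with S.in≤2 t (<q v<n)
  ...   | a , b , only = p + a , p + b , λ w w<n wv → shift wv w<n
    where
    shift : ∀ {w} → arrow w (p + t) ≡ true → w < p + q → w ≡ p + a ⊎ w ≡ p + b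
    shift wv w<n with high-source wv
    ... | s , refl , st = shift-two (only s (<q w<n) st)

  sound : ∀ u v → u < p + q → v < p + q → blockSum p A B u v ≡ true → CCEℕ (p + q) arrow u v
  sound u v _ _ uv with side p u | side p v
  ... | low u<p | low v<p with R.sound u v u<p v<p (trans (sym (Adj.blockSum-low u<p v<p)) uv)
  ...   | u≢v , x , y , x<p , y<p , yu , yv , ux , vx =
    u≢v , x , y , <p+q x<p , <p+q y<p ,
    trans (blockSum-low y<p u<p) yu , trans (blockSum-low y<p v<p) yv ,
    trans (blockSum-low u<p x<p) ux , trans (blockSum-low v<p x<p) vx
  sound _ _ u<n v<n uv | high t | high s with S.sound t s (<q u<n) (<q v<n) (trans (sym Adj.blockSum-high) uv)
  ...   | t≢s , x , y , x<q , y<q , yt , ys , tx , sx =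
    t≢s ∘ +-cancelˡ-≡ p t s , p + x , p + y , +-monoʳ-< p x<q , +-monoʳ-< p y<q ,
    trans blockSum-high yt , trans blockSum-high ys , trans blockSum-high tx , trans blockSum-high sx
  sound _ _ _ _ uv | low u<p | high _ = contradiction (trans (sym uv) (Adj.blockSum-low-high u<p)) true≢false
  sound _ _ _ _ uv | high _ | low v<p = contradiction (trans (sym uv) (Adj.blockSum-high-low v<p)) true≢false

  complete : ∀ u v → u < p + q → v < p + q → CCEℕ (p + q) arrow u v → blockSum p A B u v ≡ true
  complete u v _ _ (u≢v , x , y , _ , _ , yu , yv , ux , vx) with side p u
  ... | low u<p with low-source u<p yu | low-target u<p ux
  ...   | y<p , Ryu | x<p , Rux with low-target y<p yv
  ...     | v<p , Ryv =
    trans (Adj.blockSum-low u<p v<p)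
          (R.complete u v u<p v<p (u≢v , x , y , x<p , y<p , Ryu , Ryv , Rux , proj₂ (low-target v<p vx)))
  complete _ _ u<n v<n (u≢v , x , y , x<n , y<n , yu , yv , ux , vx) | high t
    with high-source yu | high-target ux
  ... | y′ , refl , Syu | x′ , refl , Sux with high-target yv
  ...   | s , refl , Syv =
    trans Adj.blockSum-high
          (S.complete t s (<q u<n) (<q v<n)
             (u≢v ∘ cong (p +_) , x′ , y′ , <q x<n , <q y<n , Syu , Syv , Sux , trans (sym blockSum-high) vx))

  realization : Realization (p + q) (blockSum p A B)
  realization = record
    { arrow = arrow ; arrow-irrefl = arrow-irrefl ; out≤2 = out≤2 ; in≤2 = in≤2 ; sound = sound ; complete = complete }

no-edge-across : ∀ {p c u s} → c (pred p) ≡ false → u < p → ¬ ForestEdge c u (p + s)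
no-edge-across {p} {c} {u} {s} break u<p (inj₁ (e , cu)) =
  true≢false (trans (sym cu) (trans (cong (c ∘ pred) 1+u≡p) break))
  where
  1+u≡p : suc u ≡ p
  1+u≡p = ≤-antisym u<p (subst (p ≤_) (sym e) (m≤m+n p s))
no-edge-across {p} {s = s} _ u<p (inj₂ (e , _)) =
  <⇒≱ u<p (≤-trans (m≤m+n p s) (≤-trans (n≤1+n _) (≤-reflexive e)))

forestAdj-split : ∀ p c → c (pred p) ≡ false → ∀ u v →
                  forestAdj c u v ≡ blockSum p (forestAdj c) (forestAdj (λ i → c (p + i))) u v
forestAdj-split p c break u v = split u v (side p u) (side p v)
  where
  open BlockSum p (forestAdj c) (forestAdj (λ i → c (p + i)))
  split : ∀ u v → Side p u → Side p v → forestAdj c u v ≡ blockSum p (forestAdj c) (forestAdj (λ i → c (p + i))) u v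
  split u v (low u<p) (low v<p) = sym (blockSum-low u<p v<p)
  split _ _ (high t) (high s) = trans (forestAdj-shift p c t s) (sym blockSum-high)
  split u _ (low u<p) (high s) =
    trans (forestAdj-false c u (p + s) (no-edge-across {c = c} break u<p)) (sym (blockSum-low-high u<p))
  split _ v (high t) (low v<p) =
    trans (forestAdj-false c (p + t) v (no-edge-across {c = c} break v<p ∘ Data.Sum.swap)) (sym (blockSum-high-low v<p))

record Ordering (n : ℕ) : Set where
  field
    at : ℕ → ℕ
    pos : ℕ → ℕ
    at<n : ∀ j → j < n → at j < n
    pos<n : ∀ v → v < n → pos v < n
    pos-at : ∀ j → j < n → pos (at j) ≡ j
    at-pos : ∀ v → v < n → at (pos v) ≡ v

  at-injective : ∀ {i j} → i < n → j < n → at i ≡ at j → i ≡ j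
  at-injective {i} {j} i<n j<n e = trans (sym (pos-at i i<n)) (trans (cong pos e) (pos-at j j<n))

identity : ∀ n → Ordering n
identity n = record
  { at = λ j → j ; pos = λ v → v ; at<n = λ _ j<n → j<n ; pos<n = λ _ v<n → v<n
  ; pos-at = λ _ _ → refl ; at-pos = λ _ _ → refl }

Pair : (ℕ → ℕ) → ℕ → ℕ → ℕ → Set
Pair f j u v = (u ≡ f j × v ≡ f (suc j)) ⊎ (v ≡ f j × u ≡ f (suc j))

Consecutive : (ℕ → ℕ) → ℕ → ℕ → ℕ → Set
Consecutive f n u v = ∃ λ j → suc j < n × Pair f j u v

Consecutive-sym : ∀ {f n u v} → Consecutive f n u v → Consecutive f n v u
Consecutive-sym (j , 1+j<n , e) = j , 1+j<n , Data.Sum.swap e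

-- The digraph with arcs λ j → π j and λ (j + 1) → π j: two vertices have a common out-neighbour
-- iff they are consecutive in λ, and a common in-neighbour iff they are consecutive in π.
module Zigzag {n : ℕ} (λ′ π : Ordering n)
  (no-loop₀ : ∀ j → j < n → Ordering.at π j ≢ Ordering.at λ′ j)
  (no-loop₁ : ∀ j → suc j < n → Ordering.at π j ≢ Ordering.at λ′ (suc j)) where

  module L = Ordering λ′
  module P = Ordering π

  previous : ℕ → ℕ → Bool
  previous zero v = false
  previous (suc j) v = v ≡ᵇ P.at j

  arrow : ℕ → ℕ → Bool
  arrow u v = not (u ≡ᵇ v) ∧ ((v ≡ᵇ P.at (L.pos u)) ∨ previous (L.pos u) v)

  arrow-irrefl : ∀ u → arrow u u ≡ false
  arrow-irrefl u rewrite ≡⇒≡ᵇ-true {u} refl = refl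

  ArrowTarget : ℕ → ℕ → Set
  ArrowTarget j v = v ≡ P.at j ⊎ ∃ λ i → j ≡ suc i × v ≡ P.at i

  arrow-true : ∀ u v → arrow u v ≡ true → u ≢ v × ArrowTarget (L.pos u) v
  arrow-true u v e with u ≡ᵇ v in u≡ᵇv
  ... | true = contradiction (sym e) true≢false
  ... | false = (λ u≡v → true≢false (trans (sym (≡⇒≡ᵇ-true u≡v)) u≡ᵇv)) , target (L.pos u) e
    where
    target : ∀ j → ((v ≡ᵇ P.at j) ∨ previous j v) ≡ true → ArrowTarget j v
    target j e′ with v ≡ᵇ P.at j in hit
    ... | true = inj₁ (≡ᵇ-true⇒≡ hit)
    target (suc j) e′ | false = inj₂ (j , refl , ≡ᵇ-true⇒≡ e′)

  arrow-intro : ∀ u v → u ≢ v → ArrowTarget (L.pos u) v → arrow u v ≡ true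
  arrow-intro u v u≢v target with u ≡ᵇ v in u≡ᵇv
  ... | true = contradiction (≡ᵇ-true⇒≡ u≡ᵇv) u≢v
  arrow-intro u v u≢v (inj₁ refl) | false rewrite ≡⇒≡ᵇ-true {P.at (L.pos u)} refl = refl
  arrow-intro u v u≢v (inj₂ (i , e , refl)) | false rewrite e | ≡⇒≡ᵇ-true {P.at i} refl = ∨-zeroʳ _

  arrow₀ : ∀ j → j < n → arrow (L.at j) (P.at j) ≡ true
  arrow₀ j j<n = arrow-intro _ _ (no-loop₀ j j<n ∘ sym) (inj₁ (cong P.at (sym (L.pos-at j j<n))))

  arrow₁ : ∀ j → suc j < n → arrow (L.at (suc j)) (P.at j) ≡ true
  arrow₁ j 1+j<n = arrow-intro _ _ (no-loop₁ j 1+j<n ∘ sym) (inj₂ (j , L.pos-at (suc j) 1+j<n , refl))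

  out≤2 : ∀ u → u < n → WithinTwo n (λ v → arrow u v ≡ true)
  out≤2 u _ = P.at (L.pos u) , P.at (pred (L.pos u)) , λ v _ e → two (proj₂ (arrow-true u v e))
    where
    two : ∀ {v} → ArrowTarget (L.pos u) v → v ≡ P.at (L.pos u) ⊎ v ≡ P.at (pred (L.pos u))
    two (inj₁ e) = inj₁ e
    two (inj₂ (i , e , e′)) = inj₂ (trans e′ (cong (P.at ∘ pred) (sym e)))

  arrow-source : ∀ u x → u < n → x < n → arrow u x ≡ true →
                 u ≡ L.at (P.pos x) ⊎ (suc (P.pos x) < n × u ≡ L.at (suc (P.pos x)))
  arrow-source u x u<n x<n e with proj₂ (arrow-true u x e)
  ... | inj₁ refl = inj₁ (trans (sym (L.at-pos u u<n)) (cong L.at (sym (P.pos-at _ (L.pos<n u u<n)))))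
  ... | inj₂ (i , e₁ , refl) = inj₂ (subst (_< n) (sym 1+pos≡) (subst (_< n) e₁ (L.pos<n u u<n)) ,
                                     trans (sym (L.at-pos u u<n)) (cong L.at (trans e₁ (sym 1+pos≡))))
    where
    1+pos≡ : suc (P.pos (P.at i)) ≡ suc i
    1+pos≡ = cong suc (P.pos-at i (<-trans (n<1+n i) (subst (_< n) e₁ (L.pos<n u u<n))))

  in≤2 : ∀ v → v < n → WithinTwo n (λ u → arrow u v ≡ true)
  in≤2 v v<n = L.at (P.pos v) , L.at (suc (P.pos v)) , λ u u<n e → two (arrow-source u v u<n v<n e)
    where
    two : ∀ {u} → u ≡ L.at (P.pos v) ⊎ (suc (P.pos v) < n × u ≡ L.at (suc (P.pos v))) →
          u ≡ L.at (P.pos v) ⊎ u ≡ L.at (suc (P.pos v))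
    two (inj₁ e) = inj₁ e
    two (inj₂ (_ , e)) = inj₂ e

  distinct : ∀ {j u v} → suc j < n → Pair L.at j u v → u ≢ v
  distinct {j} 1+j<n (inj₁ (refl , refl)) e = 1+n≢n (sym (L.at-injective (<-trans (n<1+n j) 1+j<n) 1+j<n e))
  distinct {j} 1+j<n (inj₂ (refl , refl)) e = 1+n≢n (L.at-injective 1+j<n (<-trans (n<1+n j) 1+j<n) e)

  common-out : ∀ {j u v} → suc j < n → Pair L.at j u v → arrow u (P.at j) ≡ true × arrow v (P.at j) ≡ true
  common-out {j} 1+j<n (inj₁ (refl , refl)) = arrow₀ j (<-trans (n<1+n j) 1+j<n) , arrow₁ j 1+j<n
  common-out {j} 1+j<n (inj₂ (refl , refl)) = arrow₁ j 1+j<n , arrow₀ j (<-trans (n<1+n j) 1+j<n)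

  common-in : ∀ {i u v} → suc i < n → Pair P.at i u v →
              arrow (L.at (suc i)) u ≡ true × arrow (L.at (suc i)) v ≡ true
  common-in {i} 1+i<n (inj₁ (refl , refl)) = arrow₁ i 1+i<n , arrow₀ (suc i) 1+i<n
  common-in {i} 1+i<n (inj₂ (refl , refl)) = arrow₀ (suc i) 1+i<n , arrow₁ i 1+i<n

  out-pair : ∀ {u v x} → u ≢ v →
             u ≡ L.at (P.pos x) ⊎ (suc (P.pos x) < n × u ≡ L.at (suc (P.pos x))) →
             v ≡ L.at (P.pos x) ⊎ (suc (P.pos x) < n × v ≡ L.at (suc (P.pos x))) → Consecutive L.at n u v
  out-pair u≢v (inj₁ e) (inj₁ e′) = contradiction (trans e (sym e′)) u≢v
  out-pair u≢v (inj₂ (_ , e)) (inj₂ (_ , e′)) = contradiction (trans e (sym e′)) u≢v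
  out-pair {x = x} _ (inj₁ e) (inj₂ (l , e′)) = P.pos x , l , inj₁ (e , e′)
  out-pair {x = x} _ (inj₂ (l , e)) (inj₁ e′) = P.pos x , l , inj₂ (e′ , e)

  in-pair : ∀ {u v y} → y < n → u ≢ v → ArrowTarget (L.pos y) u → ArrowTarget (L.pos y) v → Consecutive P.at n u v
  in-pair _ u≢v (inj₁ e) (inj₁ e′) = contradiction (trans e (sym e′)) u≢v
  in-pair _ u≢v (inj₂ (i , e₁ , e)) (inj₂ (i′ , e₁′ , e′)) =
    contradiction (trans e (trans (cong P.at (suc-injective (trans (sym e₁) e₁′))) (sym e′))) u≢v
  in-pair {y = y} y<n _ (inj₁ e) (inj₂ (i , e₁ , e′)) =
    i , subst (_< n) e₁ (L.pos<n y y<n) , inj₂ (e′ , trans e (cong P.at e₁))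
  in-pair {y = y} y<n _ (inj₂ (i , e₁ , e)) (inj₁ e′) =
    i , subst (_< n) e₁ (L.pos<n y y<n) , inj₁ (e , trans e′ (cong P.at e₁))

  realization : ∀ adj → (∀ u v → u < n → v < n → adj u v ≡ true → Consecutive L.at n u v × Consecutive P.at n u v) →
                (∀ u v → u < n → v < n → Consecutive L.at n u v → Consecutive P.at n u v → adj u v ≡ true) →
                Realization n adj
  realization adj consecutive consecutive⇒adj = record
    { arrow = arrow ; arrow-irrefl = arrow-irrefl ; out≤2 = out≤2 ; in≤2 = in≤2
    ; sound = snd ; complete = cmp }
    where
    snd : ∀ u v → u < n → v < n → adj u v ≡ true → CCEℕ n arrow u v
    snd u v u<n v<n e with consecutive u v u<n v<n e
    ... | (j , 1+j<n , λ-pair) , (i , 1+i<n , π-pair) =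
      distinct 1+j<n λ-pair , P.at j , L.at (suc i) ,
      P.at<n j (<-trans (n<1+n j) 1+j<n) , L.at<n (suc i) 1+i<n ,
      proj₁ (common-in 1+i<n π-pair) , proj₂ (common-in 1+i<n π-pair) ,
      proj₁ (common-out 1+j<n λ-pair) , proj₂ (common-out 1+j<n λ-pair)
    cmp : ∀ u v → u < n → v < n → CCEℕ n arrow u v → adj u v ≡ true
    cmp u v u<n v<n (u≢v , x , y , x<n , y<n , yu , yv , ux , vx) = consecutive⇒adj u v u<n v<n
      (out-pair u≢v (arrow-source u x u<n x<n ux) (arrow-source v x v<n x<n vx))
      (in-pair y<n u≢v (proj₂ (arrow-true y u yu)) (proj₂ (arrow-true y v yv)))

data Block (p q : ℕ) : ℕ → Set where
  first : ∀ {j} → j < p → Block p q j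
  second : ∀ {t} → t < q → Block p q (p + t)

block : ∀ p q j → j < p + q → Block p q j
block p q j j<p+q with side p j
... | low j<p = first j<p
... | high t = second (+-cancelˡ-< p t q j<p+q)

Neighbours : ℕ → ℕ → Set
Neighbours u v = suc u ≡ v ⊎ suc v ≡ u

consecutive-neighbours : ∀ {j u v} → Pair (λ i → i) j u v → Neighbours u v
consecutive-neighbours (inj₁ (refl , refl)) = inj₁ refl
consecutive-neighbours (inj₂ (refl , refl)) = inj₂ refl

data Step (c : ℕ → Bool) (at : ℕ → ℕ) (i : ℕ) : Set where
  step-up : at (suc i) ≡ suc (at i) × c (at i) ≡ true → Step c at i
  step-down : at i ≡ suc (at (suc i)) × c (at (suc i)) ≡ true → Step c at i
  step-apart : suc (at i) ≢ at (suc i) × suc (at (suc i)) ≢ at i → Step c at i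

step⇒edge⊎apart : ∀ {c at i} → Step c at i → ForestEdge c (at i) (at (suc i)) ⊎ ¬ Neighbours (at i) (at (suc i))
step⇒edge⊎apart (step-up (e , cc)) = inj₁ (inj₁ (sym e , cc))
step⇒edge⊎apart (step-down (e , cc)) = inj₁ (inj₂ (sym e , cc))
step⇒edge⊎apart (step-apart (n₁ , n₂)) = inj₂ λ { (inj₁ e) → n₁ e ; (inj₂ e) → n₂ e }

-- The forest edges are the pairs consecutive both in the natural order and in σ.
module ForestOrdering {n : ℕ} (c : ℕ → Bool) (σ : Ordering n)
  (steps : ∀ i → suc i < n → Step c (Ordering.at σ) i)
  (edges : ∀ j → suc j < n → c j ≡ true → Consecutive (Ordering.at σ) n j (suc j)) where

  open Ordering σ using (at)

  consecutive : ∀ u v → u < n → v < n → forestAdj c u v ≡ true →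
                Consecutive (λ j → j) n u v × Consecutive at n u v
  consecutive u v u<n v<n e with forestAdj⇒edge c u v e
  ... | inj₁ (refl , cu) = (u , v<n , inj₁ (refl , refl)) , edges u v<n cu
  ... | inj₂ (refl , cv) = (v , u<n , inj₂ (refl , refl)) , Consecutive-sym (edges v u<n cv)

  consecutive⇒adj : ∀ u v → u < n → v < n → Consecutive (λ j → j) n u v → Consecutive at n u v →
                    forestAdj c u v ≡ true
  consecutive⇒adj u v _ _ (j , _ , ℕ-pair) (i , 1+i<n , σ-pair) with step⇒edge⊎apart (steps i 1+i<n) | σ-pair
  ... | inj₁ edge | inj₁ (refl , refl) = edge⇒forestAdj c u v edge
  ... | inj₁ edge | inj₂ (refl , refl) = edge⇒forestAdj c u v (Data.Sum.swap edge)
  ... | inj₂ ¬nb | inj₁ (refl , refl) = contradiction (consecutive-neighbours ℕ-pair) ¬nb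
  ... | inj₂ ¬nb | inj₂ (refl , refl) = contradiction (Data.Sum.swap (consecutive-neighbours ℕ-pair)) ¬nb

  realization : (∀ j → j < n → at j ≢ j) → (∀ j → suc j < n → at j ≢ suc j) → Realization n (forestAdj c)
  realization loop₀ loop₁ =
    Zigzag.realization (identity n) σ loop₀ loop₁ (forestAdj c) consecutive consecutive⇒adj

  realization′ : (∀ j → j < n → j ≢ at j) → (∀ j → suc j < n → j ≢ at (suc j)) → Realization n (forestAdj c)
  realization′ loop₀ loop₁ =
    Zigzag.realization σ (identity n) loop₀ loop₁ (forestAdj c)
      (λ u v u<n v<n e → proj₂ (consecutive u v u<n v<n e) , proj₁ (consecutive u v u<n v<n e))
      (λ u v u<n v<n σ-pair ℕ-pair → consecutive⇒adj u v u<n v<n ℕ-pair σ-pair)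

-- Two and three paths

-- The paths 0 – … – (a - 1) and a – a + 1 – ⋯
twoPaths : ℕ → ℕ → Bool
twoPaths a i = not (suc i ≡ᵇ a)

twoPaths-true : ∀ {a i} → suc i ≢ a → twoPaths a i ≡ true
twoPaths-true 1+i≢a rewrite ≢⇒≡ᵇ-false 1+i≢a = refl

twoPaths-break : ∀ {a i} → twoPaths a i ≡ true → suc i ≢ a
twoPaths-break e 1+i≡a = true≢false (trans (sym e) (cong not (≡⇒≡ᵇ-true 1+i≡a)))

-- σ lists the second path a, …, a + b - 1 and then the first one 0, …, a - 1.
module Rotation (a b : ℕ) (1≤a : 1 ≤ a) (1≤b : 1 ≤ b) (3≤n : 3 ≤ a + b) where

  n : ℕ
  n = a + b
  c : ℕ → Bool
  c = twoPaths a

  at : ℕ → ℕ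
  at j = if j <ᵇ b then a + j else j ∸ b

  pos : ℕ → ℕ
  pos v = if v <ᵇ a then b + v else v ∸ a

  at-first : ∀ {t} → t < b → at t ≡ a + t
  at-first t<b rewrite <ᵇ-true t<b = refl

  at-second : ∀ {t} → at (b + t) ≡ t
  at-second {t} rewrite <ᵇ-false (m≤m+n b t) = m+n∸m≡n b t

  pos-first : ∀ {t} → t < a → pos t ≡ b + t
  pos-first t<a rewrite <ᵇ-true t<a = refl

  pos-second : ∀ {t} → pos (a + t) ≡ t
  pos-second {t} rewrite <ᵇ-false (m≤m+n a t) = m+n∸m≡n a t

  by-position : ∀ {j} → j < n → Block b a j
  by-position {j} j<n = block b a j (subst (j <_) (+-comm a b) j<n)

  σ : Ordering n
  σ = record { at = at ; pos = pos ; at<n = at<n ; pos<n = pos<n ; pos-at = pos-at ; at-pos = at-pos }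
    where
    at<n : ∀ j → j < n → at j < n
    at<n j j<n with by-position j<n
    ... | first j<b = subst (_< n) (sym (at-first j<b)) (+-monoʳ-< a j<b)
    ... | second t<a = subst (_< n) (sym at-second) (<-≤-trans t<a (m≤m+n a b))
    pos<n : ∀ v → v < n → pos v < n
    pos<n v v<n with block a b v v<n
    ... | first v<a = subst (_< n) (sym (pos-first v<a)) (subst (b + v <_) (+-comm b a) (+-monoʳ-< b v<a))
    ... | second t<b = subst (_< n) (sym pos-second) (<-≤-trans t<b (m≤n+m b a))
    pos-at : ∀ j → j < n → pos (at j) ≡ j
    pos-at j j<n with by-position j<n
    ... | first j<b = trans (cong pos (at-first j<b)) pos-second
    ... | second t<a = trans (cong pos at-second) (pos-first t<a)
    at-pos : ∀ v → v < n → at (pos v) ≡ v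
    at-pos v v<n with block a b v v<n
    ... | first v<a = trans (cong at (pos-first v<a)) at-second
    ... | second t<b = trans (cong at pos-second) (at-first t<b)

  steps : ∀ i → suc i < n → Step c at i
  steps i 1+i<n with by-position (<-trans (n<1+n i) 1+i<n)
  ... | second {t} _ = step-up (trans at-next (cong suc (sym at-second)) ,
                                subst (λ z → c z ≡ true) (sym at-second) (twoPaths-true (<⇒≢ 1+t<a)))
    where
    at-next : at (suc (b + t)) ≡ suc t
    at-next = trans (cong at (sym (+-suc b t))) at-second
    1+t<a : suc t < a
    1+t<a = +-cancelˡ-< b _ _ (subst₂ _<_ (sym (+-suc b t)) (+-comm a b) 1+i<n)
  ... | first i<b with suc i <? b
  ...   | yes 1+i<b = step-up (trans (at-first 1+i<b) (trans (+-suc a i) (cong suc (sym (at-first i<b)))) ,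
                                subst (λ z → c z ≡ true) (sym (at-first i<b)) (twoPaths-true (m≢1+m+n a ∘ sym)))
  ...   | no 1+i≮b = step-apart ((λ e → 1+n≢0 (trans e at-last)) , (λ e → wrap (trans (cong suc (sym at-last)) e)))
    where
    1+i≡b : suc i ≡ b
    1+i≡b = ≤-antisym i<b (≮⇒≥ 1+i≮b)
    at-last : at (suc i) ≡ 0
    at-last = trans (cong at (trans 1+i≡b (sym (+-identityʳ b)))) at-second
    -- at i = n - 1 ≥ 2 is no neighbour of 0
    wrap : 1 ≢ at i
    wrap e = contradiction (subst (3 ≤_) (trans n≡1+at-i (cong suc (sym e))) 3≤n) λ { (s≤s (s≤s ())) }
      where
      n≡1+at-i : a + b ≡ suc (at i)
      n≡1+at-i = trans (cong (a +_) (sym 1+i≡b)) (trans (+-suc a i) (cong suc (sym (at-first i<b))))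

  edges : ∀ j → suc j < n → c j ≡ true → Consecutive at n j (suc j)
  edges j 1+j<n cj with block a b j (<-trans (n<1+n j) 1+j<n)
  ... | first j<a = b + j , subst (_< n) (+-suc b j) (subst (b + suc j <_) (+-comm b a) (+-monoʳ-< b 1+j<a)) ,
                    inj₁ (sym at-second , sym (trans (cong at (sym (+-suc b j))) at-second))
    where
    1+j<a : suc j < a
    1+j<a = ≤∧≢⇒< j<a (twoPaths-break cj)
  ... | second {t} t<b = t , <-≤-trans 1+t<b (m≤n+m b a) ,
                         inj₁ (sym (at-first t<b) , trans (sym (+-suc a t)) (sym (at-first 1+t<b)))
    where
    1+t<b : suc t < b
    1+t<b = +-cancelˡ-< a _ _ (subst (_< a + b) (sym (+-suc a t)) 1+j<n)

  open ForestOrdering c σ steps edges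

  at≢id : ∀ j → j < n → at j ≢ j
  at≢id j j<n with by-position j<n
  ... | first j<b = λ e → <-irrefl refl (≤-trans (+-monoˡ-≤ j 1≤a) (≤-reflexive (trans (sym (at-first j<b)) e)))
  ... | second {t} _ = λ e → <-irrefl refl (≤-trans (+-monoˡ-≤ t 1≤b) (≤-reflexive (trans (sym e) at-second)))

  at≢suc : 2 ≤ a → ∀ j → suc j < n → at j ≢ suc j
  at≢suc 2≤a j 1+j<n with by-position (<-trans (n<1+n j) 1+j<n)
  ... | first j<b = λ e → <-irrefl refl (≤-trans (+-monoˡ-≤ j 2≤a) (≤-reflexive (trans (sym (at-first j<b)) e)))
  ... | second {t} _ = λ e → <-irrefl refl (≤-trans (s≤s (m≤n+m t b)) (≤-reflexive (sym (trans (sym at-second) e))))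

  pred≢at : 2 ≤ b → ∀ k → k < n → ∀ j → suc j ≡ k → j ≢ at k
  pred≢at 2≤b k k<n j 1+j≡k with by-position k<n
  ... | first k<b = λ e → <-irrefl refl (≤-trans (m≤n+m (suc j) a)
                                      (≤-reflexive (sym (trans e (trans (at-first k<b) (cong (a +_) (sym 1+j≡k)))))))
  ... | second {t} _ = λ e → <-irrefl refl (≤-trans (≤-pred (≤-trans (+-monoˡ-≤ t 2≤b) (≤-reflexive (sym 1+j≡k))))
                                            (≤-reflexive (trans e at-second)))

  -- Zigzag's loop conditions need a ≥ 2 when λ is the natural order, and b ≥ 2 when λ is σ.
  realization-long-first : 2 ≤ a → Realization n (forestAdj c)
  realization-long-first 2≤a = realization at≢id (at≢suc 2≤a)

  realization-long-second : 2 ≤ b → Realization n (forestAdj c)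
  realization-long-second 2≤b = realization′ (λ j j<n → at≢id j j<n ∘ sym) (λ j 1+j<n → pred≢at 2≤b (suc j) 1+j<n j refl)

twoPaths-realization : ∀ a m → 1 ≤ a → 1 ≤ m → Realization (a + m) (forestAdj (twoPaths a))
twoPaths-realization (suc (suc a)) m _ 1≤m =
  Rotation.realization-long-first (2 + a) m (s≤s z≤n) 1≤m (s≤s (s≤s (≤-trans 1≤m (m≤n+m m a)))) (s≤s (s≤s z≤n))
twoPaths-realization 1 (suc (suc m)) _ _ =
  Rotation.realization-long-second 1 (2 + m) ≤-refl (s≤s z≤n) (s≤s (s≤s (s≤s z≤n))) (s≤s (s≤s z≤n))
twoPaths-realization 1 1 _ _ = Realization-cong isolated (edgeless 2)
  where
  isolated : ∀ u v → u < 2 → v < 2 → false ≡ forestAdj (twoPaths 1) u v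
  isolated 0 0 _ _ = refl
  isolated 0 1 _ _ = refl
  isolated 1 0 _ _ = refl
  isolated 1 1 _ _ = refl
  isolated (suc (suc _)) _ (s≤s (s≤s ())) _
  isolated _ (suc (suc _)) _ (s≤s (s≤s ()))

data Block₃ (p q r : ℕ) : ℕ → Set where
  first₃ : ∀ {j} → j < p → Block₃ p q r j
  second₃ : ∀ {t} → t < q → Block₃ p q r (p + t)
  third₃ : ∀ {t} → t < r → Block₃ p q r (p + q + t)

block₃ : ∀ p q r j → j < p + q + r → Block₃ p q r j
block₃ p q r j j<n with block (p + q) r j j<n
... | second t<r = third₃ t<r
... | first j<p+q with block p q j j<p+q
...   | first j<p = first₃ j<p
...   | second t<q = second₃ t<q

-- The paths 0 – … – (a - 1), a – … – (ab - 1) and ab – ab + 1 – ⋯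
threePaths : ℕ → ℕ → ℕ → Bool
threePaths a ab i = twoPaths a i ∧ twoPaths ab i

threePaths-true : ∀ {a ab i} → suc i ≢ a → suc i ≢ ab → threePaths a ab i ≡ true
threePaths-true 1+i≢a 1+i≢ab = cong₂ _∧_ (twoPaths-true 1+i≢a) (twoPaths-true 1+i≢ab)

threePaths-break : ∀ {a ab i} → threePaths a ab i ≡ true → suc i ≢ a × suc i ≢ ab
threePaths-break e = twoPaths-break (proj₁ (∧-true e)) , twoPaths-break (proj₂ (∧-true e))

-- σ lists the third path, then the first one backwards, then the second one.
module ThreePaths₁ (a b d : ℕ) (2≤a : 2 ≤ a) (1≤b : 1 ≤ b) (2≤d : 2 ≤ d) (a≤d : a ≤ d) where
  n : ℕ
  n = a + b + d
  c : ℕ → Bool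
  c = threePaths a (a + b)
  1≤a : 1 ≤ a
  1≤a = ≤-trans (s≤s z≤n) 2≤a

  at : ℕ → ℕ
  at j = if j <ᵇ d then a + b + j else (if j <ᵇ d + a then pred a ∸ (j ∸ d) else j ∸ d)
  pos : ℕ → ℕ
  pos v = if v <ᵇ a then d + (pred a ∸ v) else (if v <ᵇ a + b then d + v else v ∸ (a + b))

  at-block₁ : ∀ t → t < d → at t ≡ a + b + t
  at-block₁ t t<d rewrite <ᵇ-true t<d = refl
  at-block₂ : ∀ t → t < a → at (d + t) ≡ pred a ∸ t
  at-block₂ t t<a rewrite <ᵇ-false (m≤m+n d t) | <ᵇ-true (+-monoʳ-< d t<a) | m+n∸m≡n d t = refl
  at-block₃ : ∀ t → at (d + a + t) ≡ a + t
  at-block₃ t rewrite <ᵇ-false (≤-trans (m≤m+n d a) (m≤m+n (d + a) t))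
             | <ᵇ-false (m≤m+n (d + a) t) | +-assoc d a t = m+n∸m≡n d (a + t)
  pos-path₁ : ∀ t → t < a → pos t ≡ d + (pred a ∸ t)
  pos-path₁ t t<a rewrite <ᵇ-true t<a = refl
  pos-path₂ : ∀ t → t < b → pos (a + t) ≡ d + a + t
  pos-path₂ t t<b rewrite <ᵇ-false (m≤m+n a t) | <ᵇ-true (+-monoʳ-< a t<b) = sym (+-assoc d a t)
  pos-path₃ : ∀ t → pos (a + b + t) ≡ t
  pos-path₃ t rewrite <ᵇ-false (≤-trans (m≤m+n a b) (m≤m+n (a + b) t))
             | <ᵇ-false (m≤m+n (a + b) t) = m+n∸m≡n (a + b) t

  n-rearranged : d + a + b ≡ n
  n-rearranged = trans (+-comm (d + a) b) (trans (sym (+-assoc b d a)) (trans (cong (_+ a) (+-comm b d)) (trans (+-assoc d b a) (trans (+-comm d (b + a)) (cong (_+ d) (+-comm b a))))))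

  by-position : ∀ j → j < n → Block₃ d a b j
  by-position j j<n = block₃ d a b j (subst (j <_) (sym n-rearranged) j<n)
  by-value : ∀ j → j < n → Block₃ a b d j
  by-value j j<n = block₃ a b d j j<n

  path₁<n : ∀ {x} → x < a → x < n
  path₁<n x<a = <-≤-trans x<a (≤-trans (m≤m+n a b) (m≤m+n (a + b) d))
  path₂<n : ∀ {t} → t < b → a + t < n
  path₂<n t<b = <-≤-trans (+-monoʳ-< a t<b) (m≤m+n (a + b) d)
  path₃<n : ∀ {t} → t < d → a + b + t < n
  path₃<n t<d = +-monoʳ-< (a + b) t<d
  block₁<n : ∀ {t} → t < d → t < n
  block₁<n t<d = <-≤-trans t<d (m≤n+m d (a + b))
  block₂<n : ∀ {t} → t < a → d + t < n
  block₂<n {t} t<a = subst (d + t <_) n-rearranged (<-≤-trans (+-monoʳ-< d t<a) (m≤m+n (d + a) b))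
  block₃<n : ∀ {t} → t < b → d + a + t < n
  block₃<n {t} t<b = subst (d + a + t <_) n-rearranged (+-monoʳ-< (d + a) t<b)
  reversed<a : ∀ t → pred a ∸ t < a
  reversed<a t = ≤-<-trans (m∸n≤m (pred a) t) (pred< 1≤a)

  at<n : ∀ j → j < n → at j < n
  at<n j j<n with by-position j j<n
  ... | first₃ j<d = subst (_< n) (sym (at-block₁ j j<d)) (path₃<n j<d)
  ... | second₃ {t} t<a = subst (_< n) (sym (at-block₂ t t<a)) (path₁<n (reversed<a t))
  ... | third₃ {t} t<b = subst (_< n) (sym (at-block₃ t)) (path₂<n t<b)

  pos<n : ∀ j → j < n → pos j < n
  pos<n j j<n with by-value j j<n
  ... | first₃ j<a = subst (_< n) (sym (pos-path₁ j j<a)) (block₂<n (reversed<a j))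
  ... | second₃ {t} t<b = subst (_< n) (sym (pos-path₂ t t<b)) (block₃<n t<b)
  ... | third₃ {t} t<d = subst (_< n) (sym (pos-path₃ t)) (block₁<n t<d)

  pos-at : ∀ j → j < n → pos (at j) ≡ j
  pos-at j j<n with by-position j j<n
  ... | first₃ j<d = trans (cong pos (at-block₁ j j<d)) (pos-path₃ j)
  ... | second₃ {t} t<a = trans (cong pos (at-block₂ t t<a)) (trans (pos-path₁ _ (reversed<a t)) (cong (d +_) (m∸[m∸n]≡n (<⇒≤pred t<a))))
  ... | third₃ {t} t<b = trans (cong pos (at-block₃ t)) (pos-path₂ t t<b)

  at-pos : ∀ j → j < n → at (pos j) ≡ j
  at-pos j j<n with by-value j j<n
  ... | first₃ j<a = trans (cong at (pos-path₁ j j<a)) (trans (at-block₂ _ (reversed<a j)) (m∸[m∸n]≡n (<⇒≤pred j<a)))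
  ... | second₃ {t} t<b = trans (cong at (pos-path₂ t t<b)) (at-block₃ t)
  ... | third₃ {t} t<d = trans (cong at (pos-path₃ t)) (at-block₁ t t<d)

  a<a+b+ : ∀ t → a < a + b + t
  a<a+b+ t = <-≤-trans (subst (_≤ a + b) (+-comm a 1) (+-monoʳ-≤ a 1≤b)) (m≤m+n (a + b) t)

  c-third : ∀ t → c (a + b + t) ≡ true
  c-third t = threePaths-true (>⇒≢ (<-trans (a<a+b+ t) (n<1+n _))) (>⇒≢ (s≤s (m≤m+n (a + b) t)))

  steps-block₁ : ∀ {i} → i < d → Step c at i
  steps-block₁ {i} i<d with suc i <? d
  ... | yes 1+i<d = step-up (trans (at-block₁ (suc i) 1+i<d) (trans (+-suc (a + b) i) (cong suc (sym (at-block₁ i i<d)))) ,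
                          subst (λ z → c z ≡ true) (sym (at-block₁ i i<d)) (c-third i))
  ... | no 1+i≮d = step-apart (n₁ , n₂)
    where
    1+i≡d : suc i ≡ d
    1+i≡d = ≤-antisym i<d (≮⇒≥ 1+i≮d)
    at-1+i : at (suc i) ≡ pred a
    at-1+i = trans (cong at (trans 1+i≡d (sym (+-identityʳ d)))) (at-block₂ 0 (≤-trans (s≤s z≤n) 2≤a))
    n₁ : suc (at i) ≢ at (suc i)
    n₁ e = <⇒≢ (<-trans (pred< 1≤a) (<-trans (a<a+b+ i) (n<1+n _))) (sym (trans (cong suc (sym (at-block₁ i i<d))) (trans e at-1+i)))
    n₂ : suc (at (suc i)) ≢ at i
    n₂ e = >⇒≢ (a<a+b+ i) (trans (sym (at-block₁ i i<d)) (trans (sym e) (trans (cong suc at-1+i) (1+pred 1≤a))))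

  steps-block₂ : ∀ {t} → t < a → Step c at (d + t)
  steps-block₂ {t} t<a with suc t <? a
  ... | yes 1+t<a = step-down (trans (at-block₂ t t<a) (trans (m∸n≡1+m∸1+n (pred a) t (<⇒≤pred 1+t<a)) (cong suc (sym at-next))) ,
                             subst (λ z → c z ≡ true) (sym at-next) c-true)
    where
    at-next : at (suc (d + t)) ≡ pred a ∸ suc t
    at-next = trans (cong at (sym (+-suc d t))) (at-block₂ (suc t) 1+t<a)
    bound : suc (pred a ∸ suc t) < a
    bound = subst (_< a) (m∸n≡1+m∸1+n (pred a) t (<⇒≤pred 1+t<a)) (reversed<a t)
    c-true : c (pred a ∸ suc t) ≡ true
    c-true = threePaths-true (<⇒≢ bound) (<⇒≢ (<-≤-trans bound (m≤m+n a b)))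
  ... | no 1+t≮a = step-apart (n₁ , n₂)
    where
    1+t≡a : suc t ≡ a
    1+t≡a = ≤-antisym t<a (≮⇒≥ 1+t≮a)
    t≡a-1 : t ≡ pred a
    t≡a-1 = cong pred 1+t≡a
    at≡0 : at (d + t) ≡ 0
    at≡0 = trans (at-block₂ t t<a) (trans (cong (pred a ∸_) t≡a-1) (n∸n≡0 (pred a)))
    at-next≡a : at (suc (d + t)) ≡ a
    at-next≡a = trans (cong at (trans (sym (+-suc d t)) (trans (cong (d +_) 1+t≡a) (sym (+-identityʳ (d + a)))))) (trans (at-block₃ 0) (+-identityʳ a))
    n₁ : suc (at (d + t)) ≢ at (suc (d + t))
    n₁ e = <⇒≢ 2≤a (trans (cong suc (sym at≡0)) (trans e at-next≡a))
    n₂ : suc (at (suc (d + t))) ≢ at (d + t)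
    n₂ e = 1+n≢0 (trans e at≡0)

  steps-block₃ : ∀ {t} → suc (d + a + t) < n → Step c at (d + a + t)
  steps-block₃ {t} 1+i<n = step-up (trans (cong at (sym (+-suc (d + a) t))) (trans (at-block₃ (suc t)) (trans (+-suc a t) (cong suc (sym (at-block₃ t))))) ,
                                  subst (λ z → c z ≡ true) (sym (at-block₃ t)) c-true)
    where
    1+t<b : suc t < b
    1+t<b = +-cancelˡ-< (d + a) _ _ (subst₂ _<_ (sym (+-suc (d + a) t)) (sym n-rearranged) 1+i<n)
    c-true : c (a + t) ≡ true
    c-true = threePaths-true (>⇒≢ (s≤s (m≤m+n a t))) (<⇒≢ (subst (_< a + b) (+-suc a t) (+-monoʳ-< a 1+t<b)))

  steps : ∀ i → suc i < n → Step c at i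
  steps i 1+i<n with by-position i (<-trans (n<1+n i) 1+i<n)
  ... | first₃ i<d = steps-block₁ i<d
  ... | second₃ t<a = steps-block₂ t<a
  ... | third₃ _ = steps-block₃ 1+i<n

  edges : ∀ j → suc j < n → c j ≡ true → Consecutive at n j (suc j)
  edges j 1+j<n cj with by-value j (<-trans (n<1+n j) 1+j<n)
  ... | first₃ j<a = d + k , bound , inj₂ (sym (trans (at-block₂ k (reversed<a (suc j))) (m∸[m∸n]≡n 1+j≤a-1)) ,
                                   sym (trans (cong at (sym (+-suc d k))) (trans (at-block₂ (suc k) 1+k<a) (m∸1+[m∸1+j]≡j (pred a) j 1+j≤a-1))))
    where
    1+j<a : suc j < a
    1+j<a = ≤∧≢⇒< j<a (proj₁ (threePaths-break {a} {a + b} cj))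
    1+j≤a-1 : suc j ≤ pred a
    1+j≤a-1 = <⇒≤pred 1+j<a
    k : ℕ
    k = pred a ∸ suc j
    1+k<a : suc k < a
    1+k<a = ≤-<-trans (m∸1+j<m (pred a) j 1+j≤a-1) (pred< 1≤a)
    bound : suc (d + k) < n
    bound = subst (_< n) (+-suc d k) (block₂<n 1+k<a)
  ... | second₃ {t} t<b = d + a + t , bound , inj₁ (sym (at-block₃ t) , sym (trans (cong at (sym (+-suc (d + a) t))) (trans (at-block₃ (suc t)) (+-suc a t))))
    where
    1+t<b : suc t < b
    1+t<b = ≤∧≢⇒< t<b (λ e → proj₂ (threePaths-break {a} {a + b} cj) (trans (sym (+-suc a t)) (cong (a +_) e)))
    bound : suc (d + a + t) < n
    bound = subst (_< n) (+-suc (d + a) t) (block₃<n 1+t<b)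
  ... | third₃ {t} t<d = t , block₁<n 1+t<d , inj₁ (sym (at-block₁ t (<-trans (n<1+n t) 1+t<d)) , sym (trans (at-block₁ (suc t) 1+t<d) (+-suc (a + b) t)))
    where
    1+t<d : suc t < d
    1+t<d = +-cancelˡ-< (a + b) _ _ (subst (_< n) (sym (+-suc (a + b) t)) 1+j<n)

  at≢id : ∀ j → j < n → at j ≢ j
  at≢id j j<n with by-position j j<n
  ... | first₃ j<d = λ e → <-irrefl refl (≤-trans (+-monoˡ-≤ j (≤-trans 1≤a (m≤m+n a b))) (≤-reflexive (trans (sym (at-block₁ j j<d)) e)))
  ... | second₃ {t} t<a = λ e → <⇒≢ (<-≤-trans (reversed<a t) (≤-trans a≤d (m≤m+n d t))) (trans (sym (at-block₂ t t<a)) e)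
  ... | third₃ {t} t<b = λ e → <⇒≢ gap (trans (sym (at-block₃ t)) e)
    where
    gap : a + t < d + a + t
    gap = subst (a + t <_) (sym (+-assoc d a t)) (<-≤-trans (n<1+n (a + t)) (+-monoˡ-≤ (a + t) (≤-trans (s≤s z≤n) 2≤d)))

  at≢suc : ∀ j → suc j < n → at j ≢ suc j
  at≢suc j j<n with by-position j (<-trans (n<1+n j) j<n)
  ... | first₃ j<d = λ e → <-irrefl refl (≤-trans (+-monoˡ-≤ j (≤-trans 2≤a (m≤m+n a b))) (≤-reflexive (trans (sym (at-block₁ j j<d)) e)))
  ... | second₃ {t} t<a = λ e → <⇒≢ (<-trans (<-≤-trans (reversed<a t) (≤-trans a≤d (m≤m+n d t))) (n<1+n _)) (trans (sym (at-block₂ t t<a)) e)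
  ... | third₃ {t} t<b = λ e → <⇒≢ gap (trans (sym (at-block₃ t)) e)
    where
    gap : a + t < suc (d + a + t)
    gap = s≤s (subst (a + t ≤_) (sym (+-assoc d a t)) (m≤n+m (a + t) d))

  σ : Ordering n
  σ = record { at = at ; pos = pos ; at<n = at<n ; pos<n = pos<n ; pos-at = pos-at ; at-pos = at-pos }

  realization : Realization n (forestAdj c)
  realization = ForestOrdering.realization c σ steps edges at≢id at≢suc

-- σ lists the second path, then the third one backwards, then the first one.
module ThreePaths₂ (a b d : ℕ) (3≤a : 3 ≤ a) (1≤b : 1 ≤ b) (2≤d : 2 ≤ d) (d<a : d < a) where
  n : ℕ
  n = a + b + d
  c : ℕ → Bool
  c = threePaths a (a + b)
  1≤a : 1 ≤ a
  1≤a = ≤-trans (s≤s z≤n) 3≤a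
  1≤d : 1 ≤ d
  1≤d = ≤-trans (s≤s z≤n) 2≤d

  at : ℕ → ℕ
  at j = if j <ᵇ b then a + j else (if j <ᵇ b + d then a + b + (pred d ∸ (j ∸ b)) else j ∸ (b + d))
  pos : ℕ → ℕ
  pos v = if v <ᵇ a then b + d + v else (if v <ᵇ a + b then v ∸ a else b + (pred d ∸ (v ∸ (a + b))))

  at-block₁ : ∀ t → t < b → at t ≡ a + t
  at-block₁ t t<b rewrite <ᵇ-true t<b = refl
  at-block₂ : ∀ t → t < d → at (b + t) ≡ a + b + (pred d ∸ t)
  at-block₂ t t<d rewrite <ᵇ-false (m≤m+n b t) | <ᵇ-true (+-monoʳ-< b t<d) | m+n∸m≡n b t = refl
  at-block₃ : ∀ t → at (b + d + t) ≡ t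
  at-block₃ t rewrite <ᵇ-false (≤-trans (m≤m+n b d) (m≤m+n (b + d) t))
             | <ᵇ-false (m≤m+n (b + d) t) = m+n∸m≡n (b + d) t
  pos-path₁ : ∀ t → t < a → pos t ≡ b + d + t
  pos-path₁ t t<a rewrite <ᵇ-true t<a = refl
  pos-path₂ : ∀ t → t < b → pos (a + t) ≡ t
  pos-path₂ t t<b rewrite <ᵇ-false (m≤m+n a t) | <ᵇ-true (+-monoʳ-< a t<b) = m+n∸m≡n a t
  pos-path₃ : ∀ t → pos (a + b + t) ≡ b + (pred d ∸ t)
  pos-path₃ t rewrite <ᵇ-false (≤-trans (m≤m+n a b) (m≤m+n (a + b) t))
             | <ᵇ-false (m≤m+n (a + b) t) | m+n∸m≡n (a + b) t = refl

  n-rearranged : b + d + a ≡ n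
  n-rearranged = trans (+-comm (b + d) a) (sym (+-assoc a b d))

  by-position : ∀ j → j < n → Block₃ b d a j
  by-position j j<n = block₃ b d a j (subst (j <_) (sym n-rearranged) j<n)
  by-value : ∀ j → j < n → Block₃ a b d j
  by-value j j<n = block₃ a b d j j<n

  path₁<n : ∀ {x} → x < a → x < n
  path₁<n x<a = <-≤-trans x<a (≤-trans (m≤m+n a b) (m≤m+n (a + b) d))
  path₂<n : ∀ {t} → t < b → a + t < n
  path₂<n t<b = <-≤-trans (+-monoʳ-< a t<b) (m≤m+n (a + b) d)
  path₃<n : ∀ {t} → t < d → a + b + t < n
  path₃<n t<d = +-monoʳ-< (a + b) t<d
  block₁<n : ∀ {t} → t < b → t < n
  block₁<n t<b = <-≤-trans t<b (≤-trans (m≤n+m b a) (m≤m+n (a + b) d))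
  block₂<n : ∀ {t} → t < d → b + t < n
  block₂<n {t} t<d = subst (b + t <_) n-rearranged (<-≤-trans (+-monoʳ-< b t<d) (m≤m+n (b + d) a))
  block₃<n : ∀ {t} → t < a → b + d + t < n
  block₃<n {t} t<a = subst (b + d + t <_) n-rearranged (+-monoʳ-< (b + d) t<a)
  reversed<d : ∀ t → pred d ∸ t < d
  reversed<d t = ≤-<-trans (m∸n≤m (pred d) t) (pred< 1≤d)

  at<n : ∀ j → j < n → at j < n
  at<n j j<n with by-position j j<n
  ... | first₃ j<b = subst (_< n) (sym (at-block₁ j j<b)) (path₂<n j<b)
  ... | second₃ {t} t<d = subst (_< n) (sym (at-block₂ t t<d)) (path₃<n (reversed<d t))
  ... | third₃ {t} t<a = subst (_< n) (sym (at-block₃ t)) (path₁<n t<a)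

  pos<n : ∀ j → j < n → pos j < n
  pos<n j j<n with by-value j j<n
  ... | first₃ j<a = subst (_< n) (sym (pos-path₁ j j<a)) (block₃<n j<a)
  ... | second₃ {t} t<b = subst (_< n) (sym (pos-path₂ t t<b)) (block₁<n t<b)
  ... | third₃ {t} t<d = subst (_< n) (sym (pos-path₃ t)) (block₂<n (reversed<d t))

  pos-at : ∀ j → j < n → pos (at j) ≡ j
  pos-at j j<n with by-position j j<n
  ... | first₃ j<b = trans (cong pos (at-block₁ j j<b)) (pos-path₂ j j<b)
  ... | second₃ {t} t<d = trans (cong pos (at-block₂ t t<d)) (trans (pos-path₃ _) (cong (b +_) (m∸[m∸n]≡n (<⇒≤pred t<d))))
  ... | third₃ {t} t<a = trans (cong pos (at-block₃ t)) (pos-path₁ t t<a)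

  at-pos : ∀ j → j < n → at (pos j) ≡ j
  at-pos j j<n with by-value j j<n
  ... | first₃ j<a = trans (cong at (pos-path₁ j j<a)) (at-block₃ j)
  ... | second₃ {t} t<b = trans (cong at (pos-path₂ t t<b)) (at-block₁ t t<b)
  ... | third₃ {t} t<d = trans (cong at (pos-path₃ t)) (trans (at-block₂ _ (reversed<d t)) (cong (a + b +_) (m∸[m∸n]≡n (<⇒≤pred t<d))))

  a<a+b+ : ∀ t → a < a + b + t
  a<a+b+ t = <-≤-trans (subst (_≤ a + b) (+-comm a 1) (+-monoʳ-≤ a 1≤b)) (m≤m+n (a + b) t)

  c-third : ∀ t → c (a + b + t) ≡ true
  c-third t = threePaths-true (>⇒≢ (<-trans (a<a+b+ t) (n<1+n _))) (>⇒≢ (s≤s (m≤m+n (a + b) t)))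

  steps-block₁ : ∀ {i} → i < b → Step c at i
  steps-block₁ {i} i<b with suc i <? b
  ... | yes 1+i<b = step-up (trans (at-block₁ (suc i) 1+i<b) (trans (+-suc a i) (cong suc (sym (at-block₁ i i<b)))) ,
                          subst (λ z → c z ≡ true) (sym (at-block₁ i i<b)) c-true)
    where
    c-true : c (a + i) ≡ true
    c-true = threePaths-true (>⇒≢ (s≤s (m≤m+n a i))) (<⇒≢ (subst (_< a + b) (+-suc a i) (+-monoʳ-< a 1+i<b)))
  ... | no 1+i≮b = step-apart (n₁ , n₂)
    where
    1+i≡b : suc i ≡ b
    1+i≡b = ≤-antisym i<b (≮⇒≥ 1+i≮b)
    at-1+i : at (suc i) ≡ a + b + pred d
    at-1+i = trans (cong at (trans 1+i≡b (sym (+-identityʳ b)))) (at-block₂ 0 1≤d)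
    1+at-i≡a+b : suc (at i) ≡ a + b
    1+at-i≡a+b = trans (cong suc (at-block₁ i i<b)) (trans (sym (+-suc a i)) (cong (a +_) 1+i≡b))
    n₁ : suc (at i) ≢ at (suc i)
    n₁ e = <⇒≢ (subst (_< a + b + pred d) (+-identityʳ (a + b)) (+-monoʳ-< (a + b) (≤-pred (subst (2 ≤_) (sym (1+pred 1≤d)) 2≤d))))
             (trans (sym 1+at-i≡a+b) (trans e at-1+i))
    n₂ : suc (at (suc i)) ≢ at i
    n₂ e = >⇒≢ (<-trans bound (n<1+n _)) (trans (cong suc (sym at-1+i)) (trans e (at-block₁ i i<b)))
      where
      bound : a + i < a + b + pred d
      bound = <-≤-trans (+-monoʳ-< a i<b) (m≤m+n (a + b) (pred d))

  steps-block₂ : ∀ {t} → t < d → Step c at (b + t)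
  steps-block₂ {t} t<d with suc t <? d
  ... | yes 1+t<d = step-down (trans (at-block₂ t t<d) (trans (cong (a + b +_) (m∸n≡1+m∸1+n (pred d) t (<⇒≤pred 1+t<d)))
                               (trans (+-suc (a + b) _) (cong suc (sym at-next)))) ,
                             subst (λ z → c z ≡ true) (sym at-next) (c-third _))
    where
    at-next : at (suc (b + t)) ≡ a + b + (pred d ∸ suc t)
    at-next = trans (cong at (sym (+-suc b t))) (at-block₂ (suc t) 1+t<d)
  ... | no 1+t≮d = step-apart (n₁ , n₂)
    where
    1+t≡d : suc t ≡ d
    1+t≡d = ≤-antisym t<d (≮⇒≥ 1+t≮d)
    at≡a+b : at (b + t) ≡ a + b
    at≡a+b = trans (at-block₂ t t<d) (trans (cong (λ z → a + b + (pred d ∸ z)) (cong pred 1+t≡d)) (trans (cong (a + b +_) (n∸n≡0 (pred d))) (+-identityʳ (a + b))))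
    at≡0 : at (suc (b + t)) ≡ 0
    at≡0 = trans (cong at (trans (sym (+-suc b t)) (trans (cong (b +_) 1+t≡d) (sym (+-identityʳ (b + d)))))) (at-block₃ 0)
    n₁ : suc (at (b + t)) ≢ at (suc (b + t))
    n₁ e = 1+n≢0 (trans e at≡0)
    n₂ : suc (at (suc (b + t))) ≢ at (b + t)
    n₂ e = <⇒≢ (<-≤-trans (≤-trans (s≤s (s≤s z≤n)) 3≤a) (m≤m+n a b)) (trans (cong suc (sym at≡0)) (trans e at≡a+b))

  steps-block₃ : ∀ {t} → suc (b + d + t) < n → Step c at (b + d + t)
  steps-block₃ {t} 1+i<n = step-up (trans (cong at (sym (+-suc (b + d) t))) (trans (at-block₃ (suc t)) (cong suc (sym (at-block₃ t)))) ,
                                  subst (λ z → c z ≡ true) (sym (at-block₃ t)) c-true)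
    where
    1+t<a : suc t < a
    1+t<a = +-cancelˡ-< (b + d) _ _ (subst₂ _<_ (sym (+-suc (b + d) t)) (sym n-rearranged) 1+i<n)
    c-true : c t ≡ true
    c-true = threePaths-true (<⇒≢ 1+t<a) (<⇒≢ (<-≤-trans 1+t<a (m≤m+n a b)))

  steps : ∀ i → suc i < n → Step c at i
  steps i 1+i<n with by-position i (<-trans (n<1+n i) 1+i<n)
  ... | first₃ i<b = steps-block₁ i<b
  ... | second₃ t<d = steps-block₂ t<d
  ... | third₃ _ = steps-block₃ 1+i<n

  edges : ∀ j → suc j < n → c j ≡ true → Consecutive at n j (suc j)
  edges j 1+j<n cj with by-value j (<-trans (n<1+n j) 1+j<n)
  ... | first₃ j<a = b + d + j , bound , inj₁ (sym (at-block₃ j) , sym (trans (cong at (sym (+-suc (b + d) j))) (at-block₃ (suc j))))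
    where
    1+j<a : suc j < a
    1+j<a = ≤∧≢⇒< j<a (proj₁ (threePaths-break {a} {a + b} cj))
    bound : suc (b + d + j) < n
    bound = subst (_< n) (+-suc (b + d) j) (block₃<n 1+j<a)
  ... | second₃ {t} t<b = t , block₁<n 1+t<b , inj₁ (sym (at-block₁ t t<b) , sym (trans (at-block₁ (suc t) 1+t<b) (+-suc a t)))
    where
    1+t<b : suc t < b
    1+t<b = ≤∧≢⇒< t<b (λ e → proj₂ (threePaths-break {a} {a + b} cj) (trans (sym (+-suc a t)) (cong (a +_) e)))
  ... | third₃ {t} t<d = b + k , bound , inj₂ (sym (trans (at-block₂ k (reversed<d (suc t))) (trans (cong (a + b +_) (m∸[m∸n]≡n 1+t≤d-1)) (+-suc (a + b) t))) ,
                                          sym (trans (cong at (sym (+-suc b k))) (trans (at-block₂ (suc k) 1+k<d) (cong (a + b +_) (m∸1+[m∸1+j]≡j (pred d) t 1+t≤d-1)))))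
    where
    1+t<d : suc t < d
    1+t<d = +-cancelˡ-< (a + b) _ _ (subst (_< n) (sym (+-suc (a + b) t)) 1+j<n)
    1+t≤d-1 : suc t ≤ pred d
    1+t≤d-1 = <⇒≤pred 1+t<d
    k : ℕ
    k = pred d ∸ suc t
    1+k<d : suc k < d
    1+k<d = ≤-<-trans (m∸1+j<m (pred d) t 1+t≤d-1) (pred< 1≤d)
    bound : suc (b + k) < n
    bound = subst (_< n) (+-suc b k) (block₂<n 1+k<d)

  at≢id : ∀ j → j < n → at j ≢ j
  at≢id j j<n with by-position j j<n
  ... | first₃ j<b = λ e → <-irrefl refl (≤-trans (+-monoˡ-≤ j 1≤a) (≤-reflexive (trans (sym (at-block₁ j j<b)) e)))
  ... | second₃ {t} t<d = λ e → >⇒≢ (gap t t<d) (trans (sym (at-block₂ t t<d)) e)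
    where
    gap : ∀ t → t < d → b + t < a + b + (pred d ∸ t)
    gap t t<d = <-≤-trans (subst (b + t <_) (+-comm b a) (+-monoʳ-< b (<-trans t<d d<a))) (m≤m+n (a + b) _)
  ... | third₃ {t} t<a = λ e → <⇒≢ gap (trans (sym (at-block₃ t)) e)
    where
    gap : t < b + d + t
    gap = <-≤-trans (n<1+n t) (+-monoˡ-≤ t (≤-trans 1≤b (m≤m+n b d)))

  at≢suc : ∀ j → suc j < n → at j ≢ suc j
  at≢suc j j<n with by-position j (<-trans (n<1+n j) j<n)
  ... | first₃ j<b = λ e → <-irrefl refl (≤-trans (+-monoˡ-≤ j (≤-trans (s≤s (s≤s z≤n)) 3≤a)) (≤-reflexive (trans (sym (at-block₁ j j<b)) e)))
  ... | second₃ {t} t<d = λ e → >⇒≢ gap (trans (sym (at-block₂ t t<d)) e)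
    where
    gap : suc (b + t) < a + b + (pred d ∸ t)
    gap = <-≤-trans (subst (_< b + a) (+-suc b t) (+-monoʳ-< b (≤-<-trans t<d d<a))) (≤-trans (≤-reflexive (+-comm b a)) (m≤m+n (a + b) _))
  ... | third₃ {t} t<a = λ e → <⇒≢ gap (trans (sym (at-block₃ t)) e)
    where
    gap : t < suc (b + d + t)
    gap = s≤s (m≤n+m t (b + d))

  σ : Ordering n
  σ = record { at = at ; pos = pos ; at<n = at<n ; pos<n = pos<n ; pos-at = pos-at ; at-pos = at-pos }

  realization : Realization n (forestAdj c)
  realization = ForestOrdering.realization c σ steps edges at≢id at≢suc

threePaths-realization : ∀ a b m → 1 ≤ a → 1 ≤ b → 2 ≤ m → Realization (a + b + m) (forestAdj (threePaths a (a + b)))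
threePaths-realization 1 b m _ 1≤b 2≤m =
  Realization-cong (λ u v _ _ → sym (forestAdj-split 1 c refl u v))
    (DisjointUnion.realization (Realization-cong (forestAdj-trivial c ≤-refl) (edgeless 1))
                   (twoPaths-realization b m 1≤b (≤-trans (s≤s z≤n) 2≤m)))
  where
  c : ℕ → Bool
  c = threePaths 1 (1 + b)
threePaths-realization (suc (suc a)) b m _ 1≤b 2≤m with 2 + a ≤? m
... | yes a≤m = ThreePaths₁.realization (2 + a) b m (s≤s (s≤s z≤n)) 1≤b 2≤m a≤m
... | no a≰m = ThreePaths₂.realization (2 + a) b m (≤-trans (s≤s 2≤m) (≰⇒> a≰m)) 1≤b 2≤m (≰⇒> a≰m)

-- Realising linear forests with a break

NoBreak : ℕ → (ℕ → Bool) → Set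
NoBreak n c = ∀ i → suc i < n → c i ≡ true

FirstBreak : ℕ → (ℕ → Bool) → Set
FirstBreak n c = ∃ λ b → suc b < n × c b ≡ false × (∀ i → i < b → c i ≡ true)

first-false : (c : ℕ → Bool) (k : ℕ) → (∃ λ b → b < k × c b ≡ false × (∀ i → i < b → c i ≡ true)) ⊎ (∀ i → i < k → c i ≡ true)
first-false c zero = inj₂ λ _ ()
first-false c (suc k) with first-false c k
... | inj₁ (b , b<k , cb , before) = inj₁ (b , m≤n⇒m≤1+n b<k , cb , before)
... | inj₂ all with c k in ck
...   | false = inj₁ (k , ≤-refl , ck , all)
...   | true = inj₂ λ i i<1+k → extend (m≤n⇒m<n∨m≡n (≤-pred i<1+k))
  where
  extend : ∀ {i} → i < k ⊎ i ≡ k → c i ≡ true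
  extend (inj₁ i<k) = all _ i<k
  extend (inj₂ refl) = ck

first-break : ∀ n c → FirstBreak n c ⊎ NoBreak n c
first-break n c with first-false c (pred n)
... | inj₁ (b , b<n-1 , cb , before) = inj₁ (b , <pred⇒suc< b<n-1 , cb , before)
  where
  <pred⇒suc< : ∀ {b n} → b < pred n → suc b < n
  <pred⇒suc< {n = suc n} b<n = s≤s b<n
... | inj₂ all = inj₂ λ i 1+i<n → all i (<⇒≤pred 1+i<n)

agree-across-break : ∀ {b m} {c d : ℕ → Bool} → c b ≡ false → d b ≡ false →
                     (∀ i → i < b → c i ≡ true) → (∀ i → i < b → d i ≡ true) →
                     (∀ t → suc t < m → c (suc b + t) ≡ d (suc b + t)) →
                     ∀ i → suc i < suc b + m → c i ≡ d i
agree-across-break {b} {m} cb db c-before d-before beyond i 1+i<n with <-cmp i b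
... | tri< i<b _ _ = trans (c-before i i<b) (sym (d-before i i<b))
... | tri≈ _ refl _ = trans cb (sym db)
... | tri> _ _ b<i with m≤n⇒∃[o]m+o≡n b<i
...   | t , refl = beyond t (+-cancelˡ-< (suc b) (suc t) m (subst (_< suc b + m) (sym (+-suc (suc b) t)) 1+i<n))

twoPaths-before : ∀ {b i} → i < b → twoPaths (suc b) i ≡ true
twoPaths-before i<b = twoPaths-true (<⇒≢ (s≤s i<b))

twoPaths-at : ∀ b → twoPaths (suc b) b ≡ false
twoPaths-at b rewrite ≡⇒≡ᵇ-true {b} refl = refl

twoPaths-beyond : ∀ a t → twoPaths a (a + t) ≡ true
twoPaths-beyond a t = twoPaths-true (m≢1+m+n a ∘ sym)

twoPaths-shift : ∀ a b t → twoPaths (a + b) (a + t) ≡ twoPaths b t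
twoPaths-shift a b t = cong not (trans (cong (_≡ᵇ a + b) (sym (+-suc a t))) (≡ᵇ-shift a (suc t) b))

threePaths-at : ∀ b ab → threePaths (suc b) ab b ≡ false
threePaths-at b ab rewrite twoPaths-at b = refl

threePaths-beyond : ∀ a b t → threePaths a (a + b) (a + t) ≡ twoPaths b t
threePaths-beyond a b t rewrite twoPaths-beyond a t = twoPaths-shift a b t

threePaths-before : ∀ {b i} m → i < b → threePaths (suc b) (suc b + m) i ≡ true
threePaths-before {b} m i<b = threePaths-true (<⇒≢ (s≤s i<b)) (<⇒≢ (<-≤-trans (s≤s i<b) (m≤m+n (suc b) m)))

Broken : ℕ → (ℕ → Bool) → Set
Broken n c = n ≤ 1 ⊎ ∃ λ b → suc b < n × c b ≡ false

module LeadingPath (c : ℕ → Bool) (b₁ : ℕ) (cb₁ : c b₁ ≡ false) (before₁ : ∀ i → i < b₁ → c i ≡ true) where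

  then-one-path : ∀ m → suc b₁ < suc b₁ + m → NoBreak m (λ i → c (suc b₁ + i)) →
                  Realization (suc b₁ + m) (forestAdj c)
  then-one-path m 1+b₁<n none = Realization-cong
    (forestAdj-cong (agree-across-break {c = twoPaths (suc b₁)} {d = c} (twoPaths-at b₁) cb₁ (λ _ → twoPaths-before) before₁
                       (λ t 1+t<m → trans (twoPaths-beyond (suc b₁) t) (sym (none t 1+t<m)))))
    (twoPaths-realization (suc b₁) m (s≤s z≤n) (+-cancelˡ-≤ (suc b₁) 1 m (subst (_≤ suc b₁ + m) (+-comm 1 (suc b₁)) 1+b₁<n)))

  module SecondPath (b₂ n₂ : ℕ) (cb₂ : c (suc b₁ + b₂) ≡ false)
                    (before₂ : ∀ i → i < b₂ → c (suc b₁ + i) ≡ true) where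

    p : ℕ
    p = suc b₁ + suc b₂

    rest : ℕ → Bool
    rest i = c (p + i)

    reassociate : ∀ {adj} → Realization (p + n₂) adj → Realization (suc b₁ + (suc b₂ + n₂)) adj
    reassociate {adj} = subst (λ z → Realization z adj) (+-assoc (suc b₁) (suc b₂) n₂)

    two-paths : Realization p (forestAdj c)
    two-paths = Realization-cong
      (forestAdj-cong (agree-across-break {c = twoPaths (suc b₁)} {d = c} (twoPaths-at b₁) cb₁ (λ _ → twoPaths-before) before₁
                         (λ t 1+t<1+b₂ → trans (twoPaths-beyond (suc b₁) t) (sym (before₂ t (≤-pred 1+t<1+b₂))))))
      (twoPaths-realization (suc b₁) (suc b₂) (s≤s z≤n) (s≤s z≤n))

    two-paths⊕ : Realization n₂ (forestAdj rest) → Realization (suc b₁ + (suc b₂ + n₂)) (forestAdj c)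
    two-paths⊕ R = reassociate (Realization-cong (λ u v _ _ → sym (forestAdj-split p c second-break u v))
                                                 (DisjointUnion.realization two-paths R))
      where
      second-break : c (pred p) ≡ false
      second-break = subst (λ z → c z ≡ false) (sym (+-suc b₁ b₂)) cb₂

    three-paths : 2 ≤ n₂ → NoBreak n₂ rest → Realization (suc b₁ + (suc b₂ + n₂)) (forestAdj c)
    three-paths 2≤n₂ none = Realization-cong
      (forestAdj-cong (agree-across-break {c = threePaths (suc b₁) p} {d = c} (threePaths-at b₁ p) cb₁
                         (λ _ → threePaths-before (suc b₂)) before₁ beyond))
      (reassociate (threePaths-realization (suc b₁) (suc b₂) n₂ (s≤s z≤n) (s≤s z≤n) 2≤n₂))
      where
      beyond : ∀ t → suc t < suc b₂ + n₂ → threePaths (suc b₁) p (suc b₁ + t) ≡ c (suc b₁ + t)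
      beyond t 1+t<n₁ = trans (threePaths-beyond (suc b₁) (suc b₂) t)
        (agree-across-break {c = twoPaths (suc b₂)} {d = λ i → c (suc b₁ + i)} (twoPaths-at b₂) cb₂ (λ _ → twoPaths-before) before₂
          (λ t′ 1+t′<n₂ → trans (twoPaths-beyond (suc b₂) t′)
                                 (sym (trans (cong c (sym (+-assoc (suc b₁) (suc b₂) t′))) (none t′ 1+t′<n₂))))
          t 1+t<n₁)

    -- The rest is realised recursively unless it is a nontrivial path, when three paths are realised at once.
    realization : (∀ c′ → Broken n₂ c′ → Realization n₂ (forestAdj c′)) → Realization (suc b₁ + (suc b₂ + n₂)) (forestAdj c)
    realization realize-rest with n₂ ≤? 1 | first-break n₂ rest
    ... | yes n₂≤1 | _ = two-paths⊕ (realize-rest rest (inj₁ n₂≤1))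
    ... | no _ | inj₁ (b₃ , 1+b₃<n₂ , cb₃ , _) = two-paths⊕ (realize-rest rest (inj₂ (b₃ , 1+b₃<n₂ , cb₃)))
    ... | no n₂≰1 | inj₂ none = three-paths (≰⇒> n₂≰1) none

realize : ∀ n c → Broken n c → Realization n (forestAdj c)
realize = <-rec _ go
  where
  go : ∀ n → (∀ {m} → m < n → ∀ c → Broken m c → Realization m (forestAdj c)) →
       ∀ c → Broken n c → Realization n (forestAdj c)
  go n _ c (inj₁ n≤1) = Realization-cong (forestAdj-trivial c n≤1) (edgeless n)
  go n rec c (inj₂ (b , 1+b<n , cb)) with first-break n c
  ... | inj₂ none = contradiction (trans (sym (none b 1+b<n)) cb) true≢false
  ... | inj₁ (b₁ , 1+b₁<n , cb₁ , before₁) with m≤n⇒∃[o]m+o≡n (<⇒≤ 1+b₁<n)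
  ...   | n₁ , refl with first-break n₁ (λ i → c (suc b₁ + i))
  ...     | inj₂ none₁ = LeadingPath.then-one-path c b₁ cb₁ before₁ n₁ 1+b₁<n none₁
  ...     | inj₁ (b₂ , 1+b₂<n₁ , cb₂ , before₂) with m≤n⇒∃[o]m+o≡n (<⇒≤ 1+b₂<n₁)
  ...       | n₂ , refl = LeadingPath.SecondPath.realization c b₁ cb₁ before₁ b₂ n₂ cb₂ before₂
                            (rec (≤-trans (s≤s (m≤n+m n₂ b₂)) (m≤n+m _ (suc b₁))))

¬nontrivial-path⇒22CCE : (G : Graph) → IsDisjointUnionOfPaths G → ¬ IsNontrivialPath G → Is22CCEGraph G
¬nontrivial-path⇒22CCE G (c , G≅forest) ¬path = realization⇒22CCE G c G≅forest (realize (size G) c broken)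
  where
  broken : Broken (size G) c
  broken with size G ≤? 1 | first-break (size G) c
  ... | yes n≤1 | _ = inj₁ n≤1
  ... | no _ | inj₁ (b , 1+b<n , cb , _) = inj₂ (b , 1+b<n , cb)
  ... | no n≰1 | inj₂ none = contradiction
    (size G , ≰⇒> n≰1 , proj₁ G≅forest ,
     λ u v → trans (proj₂ G≅forest u v) (forestAdj-cong none _ _ (toℕ<n (to (proj₁ G≅forest) u)) (toℕ<n (to (proj₁ G≅forest) v))))
    ¬path

lemma3p8 : (G : Graph) → IsSimpleGraph G → IsDisjointUnionOfPaths G →
    (Is22CCEGraph G → ¬ IsNontrivialPath G) × (¬ IsNontrivialPath G → Is22CCEGraph G)
lemma3p8 G _ paths = 22CCE⇒¬nontrivial-path G , ¬nontrivial-path⇒22CCE G paths
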